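{- Let $p$ and $q$ be positive integers. For every graph $G$ the following statements are equivalent: (i) $G$ is hereditary $(p,q)$-clique-Helly; (ii) $G$ is $(p,q')$-clique-Helly for every integer $q'\geq q$; (iii) $G$ is strong $(p,q)$-clique-Helly; (iv) every family of $p+1$ maximal cliques of $G$ is strong $(p,q)$-Helly; (v) $\varPhi_q(G)$ is hereditary $p$-clique-Helly; (vi) a clique-matrix $C(G)$ of $G$ contains no incidence matrix of $\mathcal J_{p+1,q,s}$ as a submatrix for any $s\in\{0,\ldots,q-1\}$; (vii) for each $s\in\{0,\ldots,q-1\}$, each subset $U$ of $V(G)$ with $|U|=(p+1)(q-s)+s$, and each $p+1$ pairwise disjoint $(q-s)$-subsets $T_1,\ldots,T_{p+1}$ of $U$ such that $U-T_1,\ldots,U-T_{p+1}$ are cliques of $G$, there is some $i\in\{1,\ldots,p+1\}$ and some $v\in T_i$ such that $v$ is adjacent to every vertex of $G$ (other than $v$) that is complete to $U-T_i$; (viii) $G$ contains no induced subgraph isomorphic to a $(p+1,q,s)$-ocular for any $s\in\{0,\ldots,q-1\}$.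
   Context: Graphs are finite, simple and undirected. A clique is a set of pairwise adjacent vertices; maximal means inclusion-wise maximal. A vertex $v$ is complete (resp. anticomplete) to a set $W$ if $v$ is adjacent (resp. nonadjacent) to every vertex of $W-\{v\}$. The core of a family of sets is the intersection of its members. A family is $(p,q)$-intersecting if every nonempty subfamily of at most $p$ members has core of cardinality at least $q$, and has the $(p,q)$-Helly property if every nonempty $(p,q)$-intersecting subfamily has core of cardinality at least $q$. A family $\mathcal F$ of sets is strong $(p,q)$-Helly if for every nonempty $(p,q)$-intersecting subfamily $\mathcal F'$ there is a nonempty subfamily of at most $p$ members of $\mathcal F'$ with the same core as $\mathcal F'$. A graph is $(p,q)$-clique-Helly if the family of its maximal cliques has the $(p,q)$-Helly property ($p$-clique-Helly means $(p,1)$-clique-Helly), hereditary $(p,q)$-clique-Helly (resp. hereditary $p$-clique-Helly) if every induced subgraph is $(p,q)$-clique-Helly (resp. $p$-clique-Helly), and strong $(p,q)$-clique-Helly if the family of its maximal cliques is strong $(p,q)$-Helly. $\varPhi_q(G)$ is the graph whose vertices are the cliques of cardinality $q$ of $G$, two being adjacent iff they are contained in a common clique of $G$. A clique-matrix $C(G)$ is a $(0,1)$-matrix with one row per maximal clique and one column per vertex of $G$, with a $1$ exactly when the clique contains the vertex. For $s\in\{0,\ldots,q-1\}$, $\mathcal J_{p+1,q,s}$ is the hypergraph with vertex set $V$ of cardinality $(p+1)(q-s)+s$ and the $p+1$ edges $V-T_1,\ldots,V-T_{p+1}$, where $T_1,\ldots,T_{p+1}$ are pairwise disjoint $(q-s)$-subsets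 of $V$; its incidence matrix has one row per edge and one column per vertex. For $s\in\{0,\ldots,q-1\}$, a $(p+1,q,s)$-ocular is a graph whose vertex set is the union of disjoint sets $U$ and $W$, where $|U|=(p+1)(q-s)+s$, and $T_1,\ldots,T_{p+1}$ are pairwise disjoint $(q-s)$-subsets of $U$, such that either ($\alpha_1$) $p=1$, $W=\emptyset$, and for each $i\in\{1,2\}$, $U-T_i$ is a clique but $(U-T_i)\cup\{v_i\}$ is not a clique for each $v_i\in T_i$; or ($\alpha_2$) $p\ge 2$, $W=\{w_1,\ldots,w_{p+1}\}$, $U$ is a clique, and for each $i$, $w_i$ is complete to $U-T_i$ and anticomplete to $T_i$ (the graph induced by $W$ is arbitrary). -}

module Defs where

open import Data.Nat using (ℕ; zero; suc; _+_; _*_; _∸_; _≤_; _<_)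
open import Data.Bool using (Bool; true; false)
open import Data.Fin using (Fin)
open import Data.Fin.Subset
  using (Subset; ⋂; _∈_; _∉_; _⊆_; _∩_; _∪_; _─_; ∣_∣; ⊤; ⊥; ⁅_⁆; Empty)
open import Data.List using (List; []; foldr; length)
open import Data.List.Relation.Unary.All using (All)
open import Data.List.Membership.Propositional using () renaming (_∈_ to _∈ₗ_)
open import Data.Product using (Σ; Σ-syntax; ∃; ∃-syntax; _×_; _,_)
open import Data.Sum using (_⊎_)
open import Relation.Binary.PropositionalEquality using (_≡_; _≢_)
open import Relation.Nullary using (¬_)
open import Function.Definitions using (Injective)
open import Function.Bundles using (_⇔_)

record Graph (n : ℕ) : Set where
  field
    adj    : Fin n → Fin n → Bool
    sym    : ∀ u v → adj u v ≡ adj v u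
    irrefl : ∀ v → adj v v ≡ false

open Graph public

module _ {n : ℕ} (G : Graph n) where

  Adj : Fin n → Fin n → Set
  Adj u v = adj G u v ≡ true

  IsClique : Subset n → Set
  IsClique C = ∀ u v → u ∈ C → v ∈ C → u ≢ v → Adj u v

  MaximalClique : Subset n → Set
  MaximalClique C = IsClique C × (∀ C′ → IsClique C′ → C ⊆ C′ → C′ ⊆ C)

  Complete : Fin n → Subset n → Set
  Complete v W = ∀ u → u ∈ W → u ≢ v → adj G v u ≡ true

  Anticomplete : Fin n → Subset n → Set
  Anticomplete v W = ∀ u → u ∈ W → u ≢ v → adj G v u ≡ false

InducedEmbedding : ∀ {k n} → Graph k → Graph n → (Fin k → Fin n) → Set
InducedEmbedding H G f =
  Injective _≡_ _≡_ f × (∀ i j → adj H i j ≡ adj G (f i) (f j))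

-- A family is given by its membership predicate; a (finite) subfamily is
-- given by a list of members (repetitions are harmless: only the
-- underlying set matters, and at most p members <-> a list of length ≤ p).

Family : ℕ → Set₁
Family n = Subset n → Set

core : ∀ {n} → List (Subset n) → Subset n
core = ⋂

Intersecting : ∀ {n} → ℕ → ℕ → List (Subset n) → Set
Intersecting p q F′ =
  ∀ (L : List _) → L ≢ [] → length L ≤ p → All (_∈ₗ F′) L → q ≤ ∣ core L ∣

HellyProperty : ∀ {n} → ℕ → ℕ → Family n → Set
HellyProperty p q F =
  ∀ (F′ : List _) → F′ ≢ [] → All F F′ → Intersecting p q F′ → q ≤ ∣ core F′ ∣

StrongHelly : ∀ {n} → ℕ → ℕ → Family n → Set
StrongHelly p q F =
  ∀ (F′ : List _) → F′ ≢ [] → All F F′ → Intersecting p q F′ →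
  Σ[ L ∈ List _ ] (L ≢ [] × length L ≤ p × All (_∈ₗ F′) L × core L ≡ core F′)

CliqueHelly : ∀ {n} → ℕ → ℕ → Graph n → Set
CliqueHelly p q G = HellyProperty p q (MaximalClique G)

HereditaryCliqueHelly : ∀ {n} → ℕ → ℕ → Graph n → Set
HereditaryCliqueHelly p q G =
  ∀ k (H : Graph k) (f : Fin k → Fin _) → InducedEmbedding H G f → CliqueHelly p q H

StrongCliqueHelly : ∀ {n} → ℕ → ℕ → Graph n → Set
StrongCliqueHelly p q G = StrongHelly p q (MaximalClique G)

FamilyOf : ∀ {n m} → (Fin m → Subset n) → Family n
FamilyOf K S = ∃[ i ] K i ≡ S

-- The graph Φ_q(G): vertices are the cliques of G of cardinality q, two
-- being adjacent iff (distinct and) contained in a common clique of G.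

ΦVertex : ∀ {n} → Graph n → ℕ → Subset n → Set
ΦVertex G q K = IsClique G K × ∣ K ∣ ≡ q

ΦAdj : ∀ {n} → Graph n → Subset n → Subset n → Set
ΦAdj G K K′ = K ≢ K′ × Σ[ C ∈ Subset _ ] (IsClique G C × K ⊆ C × K′ ⊆ C)

ΦInducedEmbedding : ∀ {k n} → Graph k → Graph n → ℕ → (Fin k → Subset n) → Set
ΦInducedEmbedding H G q f =
  (∀ i → ΦVertex G q (f i)) × Injective _≡_ _≡_ f ×
  (∀ i j → (adj H i j ≡ true) ⇔ ΦAdj G (f i) (f j))

-- Φ_q(G) is hereditary p-clique-Helly (p-clique-Helly = (p,1)-clique-Helly)
ΦHereditaryCliqueHelly : ∀ {n} → ℕ → ℕ → Graph n → Set
ΦHereditaryCliqueHelly p q G =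
  ∀ k (H : Graph k) (f : Fin k → Subset _) → ΦInducedEmbedding H G q f →
  CliqueHelly p 1 H

PairwiseDisjoint : ∀ {n m} → (Fin m → Subset n) → Set
PairwiseDisjoint T = ∀ i j → i ≢ j → Empty (T i ∩ T j)

-- |V(J_{p+1,q,s})| = (p+1)(q-s)+s
Jsize : ℕ → ℕ → ℕ → ℕ
Jsize p q s = suc p * (q ∸ s) + s

-- incidence matrix of J_{p+1,q,s} on vertex set Fin (Jsize p q s), given
-- the pairwise disjoint (q-s)-sets T; row i is the edge V - T i
IsJTuple : ∀ p q s → (Fin (suc p) → Subset (Jsize p q s)) → Set
IsJTuple p q s T = PairwiseDisjoint T × (∀ i → ∣ T i ∣ ≡ q ∸ s)

JIncidence : ∀ {p q s} → (Fin (suc p) → Subset (Jsize p q s)) →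
             Fin (suc p) → Fin (Jsize p q s) → Set
JIncidence T i j = j ∉ T i

-- entry of the clique-matrix: row = maximal clique K, column = vertex v
CliqueMatrixEntry : ∀ {n} → Subset n → Fin n → Set
CliqueMatrixEntry K v = v ∈ K

-- a clique-matrix of G contains the incidence matrix of J_{p+1,q,s} as a
-- submatrix: choose p+1 distinct rows (maximal cliques) and
-- (p+1)(q-s)+s distinct columns (vertices) reproducing the matrix
-- (up to the order of rows and columns).
CliqueMatrixContainsJ : ∀ {n} → Graph n → ℕ → ℕ → ℕ → Set
CliqueMatrixContainsJ {n} G p q s =
  Σ[ T ∈ (Fin (suc p) → Subset (Jsize p q s)) ] IsJTuple p q s T ×
  Σ[ r ∈ (Fin (suc p) → Subset n) ] ((∀ i → MaximalClique G (r i)) × Injective _≡_ _≡_ r ×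
  Σ[ c ∈ (Fin (Jsize p q s) → Fin n) ] (Injective _≡_ _≡_ c ×
    (∀ i j → CliqueMatrixEntry (r i) (c j) ⇔ JIncidence {p} {q} {s} T i j)))

Ocular : ∀ {k} → ℕ → ℕ → ℕ → Graph k → Set
Ocular {k} p q s H =
  Σ[ U ∈ Subset k ] Σ[ W ∈ Subset k ] Σ[ T ∈ (Fin (suc p) → Subset k) ]
    ( Empty (U ∩ W) × U ∪ W ≡ ⊤ × ∣ U ∣ ≡ Jsize p q s
    × PairwiseDisjoint T × (∀ i → T i ⊆ U) × (∀ i → ∣ T i ∣ ≡ q ∸ s)
    × (
        ( p ≡ 1 × W ≡ ⊥
        × (∀ i → IsClique H (U ─ T i)
                 × (∀ v → v ∈ T i → ¬ IsClique H ((U ─ T i) ∪ ⁅ v ⁆))))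
      ⊎
        ( 2 ≤ p
        × Σ[ w ∈ (Fin (suc p) → Fin k) ]
            ( Injective _≡_ _≡_ w × (∀ v → v ∈ W ⇔ (∃[ i ] w i ≡ v))
            × IsClique H U
            × (∀ i → Complete H (w i) (U ─ T i) × Anticomplete H (w i) (T i))))))

module Conditions (p q : ℕ) {n : ℕ} (G : Graph n) where

  cond-i : Set
  cond-i = HereditaryCliqueHelly p q G

  cond-ii : Set
  cond-ii = ∀ q′ → q ≤ q′ → CliqueHelly p q′ G

  cond-iii : Set
  cond-iii = StrongCliqueHelly p q G

  cond-iv : Set
  cond-iv = ∀ (K : Fin (suc p) → Subset n) → (∀ i → MaximalClique G (K i)) →
            Injective _≡_ _≡_ K → StrongHelly p q (FamilyOf K)

  cond-v : Set
  cond-v = ΦHereditaryCliqueHelly p q G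

  cond-vi : Set
  cond-vi = ∀ s → s < q → ¬ CliqueMatrixContainsJ G p q s

  cond-vii : Set
  cond-vii =
    ∀ s → s < q → ∀ (U : Subset n) → ∣ U ∣ ≡ Jsize p q s →
    ∀ (T : Fin (suc p) → Subset n) → PairwiseDisjoint T → (∀ i → T i ⊆ U) →
    (∀ i → ∣ T i ∣ ≡ q ∸ s) → (∀ i → IsClique G (U ─ T i)) →
    Σ[ i ∈ Fin (suc p) ] Σ[ v ∈ Fin n ]
      (v ∈ T i × (∀ u → u ≢ v → Complete G u (U ─ T i) → Adj G v u))

  cond-viii : Set
  cond-viii =
    ∀ s → s < q → ∀ k (H : Graph k) (f : Fin k → Fin n) →
    InducedEmbedding H G f → ¬ Ocular p q s H

  TFAE : Set
  TFAE = (cond-i ⇔ cond-ii) × (cond-i ⇔ cond-iii) × (cond-i ⇔ cond-iv)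
       × (cond-i ⇔ cond-v) × (cond-i ⇔ cond-vi) × (cond-i ⇔ cond-vii)
       × (cond-i ⇔ cond-viii)

module Submission where

-- Everything is reduced to one obstruction, a critical family: maximal cliques
-- M 0, …, M p any p of which share at least q vertices, while for each j the
-- common part of the other p is not contained in M j.  Such a family is
-- (p,q)-intersecting but not strong (p,q)-Helly, and it violates the
-- (p,q′)-Helly property for every q′ exceeding its core.  Conversely, members of a
-- (p,q)-intersecting family without a critical subfamily can be discarded without
-- changing the core until at most p remain.  A critical family contains a
-- J-configuration: a shared s-set S and disjoint (q ∸ s)-sets T i with T j ⊆ M i
-- exactly when j ≢ i; it is a copy of J_{p+1,q,s} in the clique matrix and
-- violates (vii).  Moving vertices of some T i into S, as long as some T i has no
-- "eye" (p ≥ 2) or some vertex of one T is complete to the other (p = 1), ends in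
-- an induced ocular, and also in q-cliques witnessing that Φ_q(G) is not
-- p-clique-Helly.  Conversely oculars, failures of Helly in induced subgraphs of
-- Φ_q(G), and copies of J_{p+1,q,s} or failures of (vii) all yield critical families.

open import Data.Bool using (Bool; true; false; _∨_)
open import Data.Bool.Properties using (∨-zeroʳ) renaming (_≟_ to _≟b_)
open import Data.Empty using () renaming (⊥ to Void; ⊥-elim to absurd)
open import Data.Fin using (Fin; zero; suc; punchIn; punchOut; inject≤; fromℕ<; _≟_; splitAt; join; _↑ˡ_; _↑ʳ_)
open import Data.Fin.Properties
  using (any?; all?; ¬∀⟶∃¬; 0≢1+n; suc-injective; inject≤-injective; injective⇒≤;
         punchInᵢ≢i; punchIn-punchOut; punchIn-injective; splitAt-↑ˡ; splitAt-↑ʳ; join-splitAt)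
open import Data.Fin.Subset
open import Data.Fin.Subset.Properties
open import Data.List as List using (List; []; _∷_; length)
open import Data.List.Membership.Propositional using () renaming (_∈_ to _∈ₗ_)
open import Data.List.Membership.Propositional.Properties using (∈-tabulate⁻; ∈-lookup)
open import Data.List.Properties using (length-tabulate)
open import Data.List.Relation.Unary.All as All using (All; []; _∷_)
open import Data.List.Relation.Unary.All.Properties using (tabulate⁺; tabulate⁻)
open import Data.List.Relation.Unary.Any as Any using (index; here; there)
open import Data.List.Relation.Unary.Any.Properties using (lookup-index)
open import Data.Nat using (ℕ; zero; suc; _+_; _*_; _∸_; _≤_; _<_; z≤n; s≤s; _≤?_; _⊔_)
open import Data.Nat.Properties
  using (≤-trans; ≤-reflexive; ≤-pred; <⇒≤; <⇒≱; <⇒≢; ≰⇒>; n≤1+n; m≤n+m; m≤m⊔n; m≤n⊔m; ⊔-lub;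
         +-comm; +-suc; +-identityʳ; +-mono-≤; +-monoʳ-≤; +-cancelʳ-≤; +-cancelʳ-≡;
         m≤n+o⇒m∸n≤o; m+n∸n≡m; m∸n+n≡m; m+[n∸m]≡n; m<n⇒0<n∸m; m∸n≢0⇒n<m; m∸n≤m; ∸-+-assoc; ∸-monoʳ-<)
open import Data.Nat.Solver using (module +-*-Solver)
open import Data.Product using (Σ-syntax; ∃-syntax; _×_; _,_; proj₁; proj₂)
open import Data.Sum using (_⊎_; inj₁; inj₂)
open import Data.Vec using ([]; _∷_; tabulate; lookup)
open import Data.Vec.Base using (here; there)
open import Data.Vec.Properties using (≡-dec; []=⇒lookup; lookup⇒[]=; lookup∘tabulate)
open import Function using (_∘_; id; case_of_)
open import Function.Bundles using (Equivalence; mk⇔; _⇔_)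
open import Function.Definitions using (Injective)
import Function.Properties.Equivalence as ⇔
open import Relation.Binary.PropositionalEquality using (_≡_; _≢_; refl; sym; trans; cong; cong₂; subst; module ≡-Reasoning)
open import Relation.Nullary using (¬_; Dec; yes; no; does)
open import Relation.Nullary.Decidable using (_×-dec_; _→-dec_; ¬?; dec-true; dec-false; does-⇔)

open import Defs renaming (sym to gsym; irrefl to girrefl)

-- Finite sets

true≢false : true ≢ false
true≢false ()

∈tabulate⁺ : ∀ {n} (f : Fin n → Bool) {x} → f x ≡ true → x ∈ tabulate f
∈tabulate⁺ f {x} e = lookup⇒[]= x (tabulate f) (trans (lookup∘tabulate f x) e)

∈tabulate⁻ : ∀ {n} (f : Fin n → Bool) {x} → x ∈ tabulate f → f x ≡ true
∈tabulate⁻ f {x} m = trans (sym (lookup∘tabulate f x)) ([]=⇒lookup m)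

_≟ˢ_ : ∀ {n} (A B : Subset n) → Dec (A ≡ B)
_≟ˢ_ = ≡-dec _≟b_

∈─⁻ : ∀ {n} (p q : Subset n) {x} → x ∈ p ─ q → x ∈ p × x ∉ q
∈─⁻ (true ∷ p) (false ∷ q) here = here , (λ ())
∈─⁻ (true ∷ p) (true ∷ q) {zero} ()
∈─⁻ (false ∷ p) (true ∷ q) {zero} ()
∈─⁻ (false ∷ p) (false ∷ q) {zero} ()
∈─⁻ (a ∷ p) (b ∷ q) (there m) = there (proj₁ (∈─⁻ p q m)) , (λ m′ → proj₂ (∈─⁻ p q m) (drop-there m′))

∈∪⁅⁆⁻ : ∀ {n} (p : Subset n) {x y} → y ∈ p ∪ ⁅ x ⁆ → y ∈ p ⊎ y ≡ x
∈∪⁅⁆⁻ p {x} m with x∈p∪q⁻ p ⁅ x ⁆ m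
... | inj₁ mp = inj₁ mp
... | inj₂ mx = inj₂ (x∈⁅y⁆⇒x≡y x mx)

∪-⊆ : ∀ {n} {p q r : Subset n} → p ⊆ r → q ⊆ r → p ∪ q ⊆ r
∪-⊆ {p = p} {q} p⊆r q⊆r m with x∈p∪q⁻ p q m
... | inj₁ mp = p⊆r mp
... | inj₂ mq = q⊆r mq

⁅⁆-⊆ : ∀ {n} {x} {p : Subset n} → x ∈ p → ⁅ x ⁆ ⊆ p
⁅⁆-⊆ {x = x} {p} x∈p m = subst (_∈ p) (sym (x∈⁅y⁆⇒x≡y x m)) x∈p

⊈⇒witness : ∀ {n} (A B : Subset n) → ¬ (A ⊆ B) → ∃[ x ] (x ∈ A × x ∉ B)
⊈⇒witness {n} A B A⊈B
  with ¬∀⟶∃¬ n (λ x → x ∈ A → x ∈ B) (λ x → (x ∈? A) →-dec (x ∈? B)) (λ h → A⊈B (λ {x} → h x))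
... | x , nimp with x ∈? A | x ∈? B
... | yes a | yes b = absurd (nimp (λ _ → b))
... | yes a | no b = x , a , b
... | no a | _ = absurd (nimp (λ a′ → absurd (a a′)))

∈⇒1≤∣p∣ : ∀ {n} {X : Subset n} {x} → x ∈ X → 1 ≤ ∣ X ∣
∈⇒1≤∣p∣ {x = x} m = subst (_≤ _) (∣⁅x⁆∣≡1 x) (p⊆q⇒∣p∣≤∣q∣ (⁅⁆-⊆ m))

1≤∣p∣⇒Nonempty : ∀ {n} (X : Subset n) → 1 ≤ ∣ X ∣ → Nonempty X
1≤∣p∣⇒Nonempty (true ∷ X) h = zero , here
1≤∣p∣⇒Nonempty (false ∷ X) h with 1≤∣p∣⇒Nonempty X h
... | x , m = suc x , there m

q∸s-sized⇒Nonempty : ∀ {n q s} (X : Subset n) → s < q → ∣ X ∣ ≡ q ∸ s → Nonempty X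
q∸s-sized⇒Nonempty X s<q c = 1≤∣p∣⇒Nonempty X (subst (1 ≤_) (sym c) (m<n⇒0<n∸m s<q))

∣p∪q∣≤∣p∣+∣q∣ : ∀ {n} (p q : Subset n) → ∣ p ∪ q ∣ ≤ ∣ p ∣ + ∣ q ∣
∣p∪q∣≤∣p∣+∣q∣ [] [] = z≤n
∣p∪q∣≤∣p∣+∣q∣ (true ∷ p) (true ∷ q) = s≤s (≤-trans (∣p∪q∣≤∣p∣+∣q∣ p q) (+-monoʳ-≤ ∣ p ∣ (n≤1+n ∣ q ∣)))
∣p∪q∣≤∣p∣+∣q∣ (true ∷ p) (false ∷ q) = s≤s (∣p∪q∣≤∣p∣+∣q∣ p q)
∣p∪q∣≤∣p∣+∣q∣ (false ∷ p) (true ∷ q) = subst (suc ∣ p ∪ q ∣ ≤_) (sym (+-suc ∣ p ∣ ∣ q ∣)) (s≤s (∣p∪q∣≤∣p∣+∣q∣ p q))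
∣p∪q∣≤∣p∣+∣q∣ (false ∷ p) (false ∷ q) = ∣p∪q∣≤∣p∣+∣q∣ p q

∣p∪q∣≡∣p∣+∣q∣ : ∀ {n} (p q : Subset n) → Empty (p ∩ q) → ∣ p ∪ q ∣ ≡ ∣ p ∣ + ∣ q ∣
∣p∪q∣≡∣p∣+∣q∣ [] [] e = refl
∣p∪q∣≡∣p∣+∣q∣ (true ∷ p) (true ∷ q) e = absurd (e (zero , here))
∣p∪q∣≡∣p∣+∣q∣ (true ∷ p) (false ∷ q) e = cong suc (∣p∪q∣≡∣p∣+∣q∣ p q (λ (x , m) → e (suc x , there m)))
∣p∪q∣≡∣p∣+∣q∣ (false ∷ p) (true ∷ q) e =
  trans (cong suc (∣p∪q∣≡∣p∣+∣q∣ p q (λ (x , m) → e (suc x , there m)))) (sym (+-suc ∣ p ∣ ∣ q ∣))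
∣p∪q∣≡∣p∣+∣q∣ (false ∷ p) (false ∷ q) e = ∣p∪q∣≡∣p∣+∣q∣ p q (λ (x , m) → e (suc x , there m))

∣p∪⁅x⁆∣≡1+∣p∣ : ∀ {n} (p : Subset n) {x} → x ∉ p → ∣ p ∪ ⁅ x ⁆ ∣ ≡ suc ∣ p ∣
∣p∪⁅x⁆∣≡1+∣p∣ p {x} x∉p = trans (∣p∪q∣≡∣p∣+∣q∣ p ⁅ x ⁆ disjoint) (trans (cong (∣ p ∣ +_) (∣⁅x⁆∣≡1 x)) (+-comm ∣ p ∣ 1))
  where
  disjoint : Empty (p ∩ ⁅ x ⁆)
  disjoint (y , m) with x∈p∩q⁻ p ⁅ x ⁆ m
  ... | y∈p , y∈⁅x⁆ = x∉p (subst (_∈ p) (x∈⁅y⁆⇒x≡y x y∈⁅x⁆) y∈p)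

p⊆[p─q]∪q : ∀ {n} (p q : Subset n) → p ⊆ (p ─ q) ∪ q
p⊆[p─q]∪q p q {x} m with x ∈? q
... | yes mq = x∈p∪q⁺ (inj₂ mq)
... | no nq = x∈p∪q⁺ (inj₁ (x∈p∧x∉q⇒x∈p─q m nq))

∣p∣≤∣p─q∣+∣q∣ : ∀ {n} (p q : Subset n) → ∣ p ∣ ≤ ∣ p ─ q ∣ + ∣ q ∣
∣p∣≤∣p─q∣+∣q∣ p q = ≤-trans (p⊆q⇒∣p∣≤∣q∣ (p⊆[p─q]∪q p q)) (∣p∪q∣≤∣p∣+∣q∣ (p ─ q) q)

∣p∣≡∣p─q∣+∣q∣ : ∀ {n} (p q : Subset n) → q ⊆ p → ∣ p ∣ ≡ ∣ p ─ q ∣ + ∣ q ∣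
∣p∣≡∣p─q∣+∣q∣ p q q⊆p = trans (cong ∣_∣ (⊆-antisym (p⊆[p─q]∪q p q) back)) (∣p∪q∣≡∣p∣+∣q∣ (p ─ q) q disjoint)
  where
  back : (p ─ q) ∪ q ⊆ p
  back m with x∈p∪q⁻ (p ─ q) q m
  ... | inj₁ m─ = p─q⊆p p q m─
  ... | inj₂ mq = q⊆p mq
  disjoint : Empty ((p ─ q) ∩ q)
  disjoint (x , m) = proj₂ (∈─⁻ p q (proj₁ (x∈p∩q⁻ (p ─ q) q m))) (proj₂ (x∈p∩q⁻ (p ─ q) q m))

∣p∣≤∣p-x∣+1 : ∀ {n} (p : Subset n) x → ∣ p ∣ ≤ ∣ p - x ∣ + 1
∣p∣≤∣p-x∣+1 p x = subst (λ k → ∣ p ∣ ≤ ∣ p - x ∣ + k) (∣⁅x⁆∣≡1 x) (∣p∣≤∣p─q∣+∣q∣ p ⁅ x ⁆)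

injective⇒∣p∣≤∣q∣ : ∀ {m n} (A : Subset m) (B : Subset n) (f : Fin m → Fin n) →
                    (∀ {x} → x ∈ A → f x ∈ B) →
                    (∀ {x y} → x ∈ A → y ∈ A → f x ≡ f y → x ≡ y) → ∣ A ∣ ≤ ∣ B ∣
injective⇒∣p∣≤∣q∣ [] B f into inj = z≤n
injective⇒∣p∣≤∣q∣ (false ∷ A) B f into inj =
  injective⇒∣p∣≤∣q∣ A B (f ∘ suc) (into ∘ there) (λ mx my e → suc-injective (inj (there mx) (there my) e))
injective⇒∣p∣≤∣q∣ (true ∷ A) B f into inj =
  ≤-trans (s≤s (injective⇒∣p∣≤∣q∣ A (B - f zero) (f ∘ suc) into′ inj′)) (x∈p⇒∣p-x∣<∣p∣ (into here))
  where
  into′ : ∀ {x} → x ∈ A → f (suc x) ∈ B - f zero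
  into′ m = x∈p∧x≢y⇒x∈p-y (into (there m)) (λ e → 0≢1+n (sym (inj (there m) here e)))
  inj′ : ∀ {x y} → x ∈ A → y ∈ A → f (suc x) ≡ f (suc y) → x ≡ y
  inj′ mx my e = suc-injective (inj (there mx) (there my) e)

subsetOfSize : ∀ {n} (X : Subset n) k → k ≤ ∣ X ∣ → Σ[ Y ∈ Subset n ] (Y ⊆ X × ∣ Y ∣ ≡ k)
subsetOfSize {n} X zero _ = ⊥ , ⊥⊆ , ∣⊥∣≡0 n
subsetOfSize (true ∷ X) (suc k) (s≤s h) with subsetOfSize X k h
... | Y , Y⊆X , c = (true ∷ Y) , s⊆s Y⊆X , cong suc c
subsetOfSize (false ∷ X) (suc k) h with subsetOfSize X (suc k) h
... | Y , Y⊆X , c = (false ∷ Y) , s⊆s Y⊆X , c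

subsetOfSize∋ : ∀ {n} (X : Subset n) {a} → a ∈ X → ∀ k → 1 ≤ k → k ≤ ∣ X ∣ →
                Σ[ Y ∈ Subset n ] (Y ⊆ X × a ∈ Y × ∣ Y ∣ ≡ k)
subsetOfSize∋ X {a} a∈X (suc k) _ h with subsetOfSize (X - a) k (+-cancelʳ-≤ 1 k ∣ X - a ∣ k+1≤)
  where
  k+1≤ : k + 1 ≤ ∣ X - a ∣ + 1
  k+1≤ = ≤-trans (≤-reflexive (+-comm k 1)) (≤-trans h (∣p∣≤∣p-x∣+1 X a))
... | Y , Y⊆ , c = Y ∪ ⁅ a ⁆ , ∪-⊆ (λ m → p─q⊆p X ⁅ a ⁆ (Y⊆ m)) (⁅⁆-⊆ a∈X) , x∈p∪q⁺ (inj₂ (x∈⁅x⁆ a)) , size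
  where
  size : ∣ Y ∪ ⁅ a ⁆ ∣ ≡ suc k
  size = trans (∣p∪⁅x⁆∣≡1+∣p∣ Y (λ a∈Y → proj₂ (∈─⁻ X ⁅ a ⁆ (Y⊆ a∈Y)) (x∈⁅x⁆ a))) (cong suc c)

image : ∀ {k n} (f : Fin k → Fin n) → Subset k → Subset n
image f C = tabulate (λ y → does (any? (λ z → (z ∈? C) ×-dec (f z ≟ y))))

image⁺ : ∀ {k n} (f : Fin k → Fin n) (C : Subset k) {z} → z ∈ C → f z ∈ image f C
image⁺ f C {z} m = ∈tabulate⁺ _ (dec-true (any? (λ z′ → (z′ ∈? C) ×-dec (f z′ ≟ f z))) (z , m , refl))

image⁻ : ∀ {k n} (f : Fin k → Fin n) (C : Subset k) {y} → y ∈ image f C → ∃[ z ] (z ∈ C × f z ≡ y)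
image⁻ f C {y} m with any? (λ z → (z ∈? C) ×-dec (f z ≟ y)) | ∈tabulate⁻ (λ y → does (any? (λ z → (z ∈? C) ×-dec (f z ≟ y)))) m
... | yes r | _ = r
... | no _ | ()

⋃ᶠ : ∀ {m n} → (Fin m → Subset n) → Subset n
⋃ᶠ {zero} T = ⊥
⋃ᶠ {suc m} T = T zero ∪ ⋃ᶠ (T ∘ suc)

⋃ᶠ⁺ : ∀ {m n} (T : Fin m → Subset n) i {x} → x ∈ T i → x ∈ ⋃ᶠ T
⋃ᶠ⁺ {suc m} T zero mx = x∈p∪q⁺ (inj₁ mx)
⋃ᶠ⁺ {suc m} T (suc i) mx = x∈p∪q⁺ (inj₂ (⋃ᶠ⁺ (T ∘ suc) i mx))

⋃ᶠ⁻ : ∀ {m n} (T : Fin m → Subset n) {x} → x ∈ ⋃ᶠ T → ∃[ i ] x ∈ T i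
⋃ᶠ⁻ {zero} T mx = absurd (∉⊥ mx)
⋃ᶠ⁻ {suc m} T mx with x∈p∪q⁻ (T zero) _ mx
... | inj₁ m0 = zero , m0
... | inj₂ m′ with ⋃ᶠ⁻ (T ∘ suc) m′
...   | i , mi = suc i , mi

∣⋃ᶠ∣≤ : ∀ {m n} (T : Fin m → Subset n) t → (∀ i → ∣ T i ∣ ≤ t) → ∣ ⋃ᶠ T ∣ ≤ m * t
∣⋃ᶠ∣≤ {zero} {n} T t h = ≤-reflexive (∣⊥∣≡0 n)
∣⋃ᶠ∣≤ {suc m} T t h = ≤-trans (∣p∪q∣≤∣p∣+∣q∣ (T zero) _) (+-mono-≤ (h zero) (∣⋃ᶠ∣≤ (T ∘ suc) t (h ∘ suc)))

∣⋃ᶠ∣≡ : ∀ {m n} (T : Fin m → Subset n) t → PairwiseDisjoint T → (∀ i → ∣ T i ∣ ≡ t) → ∣ ⋃ᶠ T ∣ ≡ m * t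
∣⋃ᶠ∣≡ {zero} {n} T t d h = ∣⊥∣≡0 n
∣⋃ᶠ∣≡ {suc m} T t d h =
  trans (∣p∪q∣≡∣p∣+∣q∣ (T zero) _ disjoint)
        (cong₂ _+_ (h zero) (∣⋃ᶠ∣≡ (T ∘ suc) t (λ i j ne → d (suc i) (suc j) (ne ∘ suc-injective)) (h ∘ suc)))
  where
  disjoint : Empty (T zero ∩ ⋃ᶠ (T ∘ suc))
  disjoint (x , mx) with x∈p∩q⁻ (T zero) _ mx
  ... | m0 , m′ with ⋃ᶠ⁻ (T ∘ suc) m′
  ...   | i , mi = d zero (suc i) (λ ()) (x , x∈p∩q⁺ (m0 , mi))

enum : ∀ {n} (U : Subset n) → Fin ∣ U ∣ → Fin n
enum (true ∷ U) zero = zero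
enum (true ∷ U) (suc i) = suc (enum U i)
enum (false ∷ U) i = suc (enum U i)

enum∈ : ∀ {n} (U : Subset n) i → enum U i ∈ U
enum∈ (true ∷ U) zero = here
enum∈ (true ∷ U) (suc i) = there (enum∈ U i)
enum∈ (false ∷ U) i = there (enum∈ U i)

enum-injective : ∀ {n} (U : Subset n) {i j} → enum U i ≡ enum U j → i ≡ j
enum-injective (true ∷ U) {zero} {zero} e = refl
enum-injective (true ∷ U) {zero} {suc j} ()
enum-injective (true ∷ U) {suc i} {zero} ()
enum-injective (true ∷ U) {suc i} {suc j} e = cong suc (enum-injective U (suc-injective e))
enum-injective (false ∷ U) e = enum-injective U (suc-injective e)

enum-surjective : ∀ {n} (U : Subset n) {x} → x ∈ U → Σ[ i ∈ Fin ∣ U ∣ ] enum U i ≡ x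
enum-surjective (true ∷ U) here = zero , refl
enum-surjective (true ∷ U) (there m) with enum-surjective U m
... | i , e = suc i , cong suc e
enum-surjective (false ∷ U) (there m) with enum-surjective U m
... | i , e = i , cong suc e

-- X ∩ U, re-indexed along the enumeration of U.
restrict : ∀ {n} (U : Subset n) → Subset n → Subset ∣ U ∣
restrict U X = tabulate (λ i → lookup X (enum U i))

restrict∈⁺ : ∀ {n} (U X : Subset n) {i} → enum U i ∈ X → i ∈ restrict U X
restrict∈⁺ U X m = ∈tabulate⁺ (λ i → lookup X (enum U i)) ([]=⇒lookup m)

restrict∈⁻ : ∀ {n} (U X : Subset n) {i} → i ∈ restrict U X → enum U i ∈ X
restrict∈⁻ U X m = lookup⇒[]= _ X (∈tabulate⁻ (λ i → lookup X (enum U i)) m)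

∣restrict∣≡∣p∣ : ∀ {n} (U X : Subset n) → X ⊆ U → ∣ restrict U X ∣ ≡ ∣ X ∣
∣restrict∣≡∣p∣ [] [] _ = refl
∣restrict∣≡∣p∣ (true ∷ U) (true ∷ X) X⊆U = cong suc (∣restrict∣≡∣p∣ U X (drop-∷-⊆ X⊆U))
∣restrict∣≡∣p∣ (true ∷ U) (false ∷ X) X⊆U = ∣restrict∣≡∣p∣ U X (drop-∷-⊆ X⊆U)
∣restrict∣≡∣p∣ (false ∷ U) (true ∷ X) X⊆U with X⊆U here
... | ()
∣restrict∣≡∣p∣ (false ∷ U) (false ∷ X) X⊆U = ∣restrict∣≡∣p∣ U X (drop-∷-⊆ X⊆U)

disjoint-⊆ : ∀ {m n} {T T′ : Fin m → Subset n} → (∀ i → T′ i ⊆ T i) → PairwiseDisjoint T → PairwiseDisjoint T′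
disjoint-⊆ {T′ = T′} T′⊆T disjoint i j i≢j (x , m) =
  disjoint i j i≢j (x , x∈p∩q⁺ (T′⊆T i (proj₁ (x∈p∩q⁻ (T′ i) (T′ j) m)) , T′⊆T j (proj₂ (x∈p∩q⁻ (T′ i) (T′ j) m))))

restrict-disjoint : ∀ {m n} (U : Subset n) {T : Fin m → Subset n} → PairwiseDisjoint T → PairwiseDisjoint (restrict U ∘ T)
restrict-disjoint U {T} disjoint i j i≢j (x , m) =
  disjoint i j i≢j (enum U x , x∈p∩q⁺ (restrict∈⁻ U (T i) (proj₁ (x∈p∩q⁻ (restrict U (T i)) _ m)) ,
                                       restrict∈⁻ U (T j) (proj₂ (x∈p∩q⁻ (restrict U (T i)) _ m))))

-- Critical families

∈⋂⁺ : ∀ {n} (L : List (Subset n)) {x} → All (x ∈_) L → x ∈ ⋂ L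
∈⋂⁺ [] [] = ∈⊤
∈⋂⁺ (K ∷ L) (m ∷ ms) = x∈p∩q⁺ (m , ∈⋂⁺ L ms)

∈⋂⁻ : ∀ {n} (L : List (Subset n)) {x} → x ∈ ⋂ L → All (x ∈_) L
∈⋂⁻ [] m = []
∈⋂⁻ (K ∷ L) m = proj₁ (x∈p∩q⁻ K (⋂ L) m) ∷ ∈⋂⁻ L (proj₂ (x∈p∩q⁻ K (⋂ L) m))

∈⋂-tabulate⁺ : ∀ {n m} (M : Fin m → Subset n) {x} → (∀ i → x ∈ M i) → x ∈ ⋂ (List.tabulate M)
∈⋂-tabulate⁺ M h = ∈⋂⁺ _ (tabulate⁺ h)

∈⋂-tabulate⁻ : ∀ {n m} (M : Fin m → Subset n) {x} → x ∈ ⋂ (List.tabulate M) → ∀ i → x ∈ M i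
∈⋂-tabulate⁻ M m = tabulate⁻ (∈⋂⁻ _ m)

coreExcept : ∀ {n p} → Fin (suc p) → (Fin (suc p) → Subset n) → Subset n
coreExcept j M = ⋂ (List.tabulate (M ∘ punchIn j))

coreExcept⁺ : ∀ {n p} j (M : Fin (suc p) → Subset n) {x} → (∀ i → i ≢ j → x ∈ M i) → x ∈ coreExcept j M
coreExcept⁺ j M h = ∈⋂-tabulate⁺ (M ∘ punchIn j) (λ i → h (punchIn j i) (punchInᵢ≢i j i))

coreExcept⁻ : ∀ {n p} j (M : Fin (suc p) → Subset n) {x} → x ∈ coreExcept j M → ∀ i → i ≢ j → x ∈ M i
coreExcept⁻ j M m i i≢j = subst (λ k → _ ∈ M k) (punchIn-punchOut (i≢j ∘ sym))
                                (∈⋂-tabulate⁻ (M ∘ punchIn j) m (punchOut (i≢j ∘ sym)))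

record CriticalFamily {n} (Fam : Subset n → Set) (p q : ℕ) : Set where
  field
    member   : Fin (suc p) → Subset n
    inFamily : ∀ j → Fam (member j)
    large    : ∀ j → q ≤ ∣ coreExcept j member ∣
    witness  : Fin (suc p) → Fin n
    witness∈ : ∀ j → witness j ∈ coreExcept j member
    witness∉ : ∀ j → witness j ∉ member j

CriticalCliques : ∀ {n} → Graph n → ℕ → ℕ → Set
CriticalCliques G = CriticalFamily (MaximalClique G)

SameCoreSubfamily : ∀ {n} → ℕ → List (Subset n) → Set
SameCoreSubfamily p F′ = Σ[ L ∈ List _ ] (L ≢ [] × length L ≤ p × All (_∈ₗ F′) L × core L ≡ core F′)

critical-map : ∀ {n p q} {F₁ F₂ : Subset n → Set} → (∀ {S} → F₁ S → F₂ S) →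
               CriticalFamily F₁ p q → CriticalFamily F₂ p q
critical-map f P = record
  { member = member ; inFamily = f ∘ inFamily ; large = large
  ; witness = witness ; witness∈ = witness∈ ; witness∉ = witness∉ }
  where open CriticalFamily P

≢[]⇒1≤length : ∀ {A : Set} (xs : List A) → xs ≢ [] → 1 ≤ length xs
≢[]⇒1≤length [] ne = absurd (ne refl)
≢[]⇒1≤length (_ ∷ _) _ = s≤s z≤n

-- Remove members of F′ one at a time as long as the core does not change.  Either
-- at most p members remain, or every remaining member is needed, and then any
-- p+1 of them form a critical family.
module Shrink {n : ℕ} (Fam : Subset n → Set) (p q : ℕ) (p≥1 : 1 ≤ p)
  (F′ : List (Subset n)) (F′⊆Fam : All Fam F′) (F′-intersecting : Intersecting p q F′) where

  m : ℕ
  m = length F′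

  member : Fin m → Subset n
  member = List.lookup F′

  members : Subset m → List (Subset n)
  members I = List.tabulate (member ∘ enum I)

  coreOf : Subset m → Subset n
  coreOf I = ⋂ (members I)

  coreOf⁺ : ∀ I {x} → (∀ k → k ∈ I → x ∈ member k) → x ∈ coreOf I
  coreOf⁺ I h = ∈⋂-tabulate⁺ (member ∘ enum I) (λ i → h (enum I i) (enum∈ I i))

  coreOf⁻ : ∀ I {x} → x ∈ coreOf I → ∀ k → k ∈ I → x ∈ member k
  coreOf⁻ I mx k mk with enum-surjective I mk
  ... | i , refl = ∈⋂-tabulate⁻ (member ∘ enum I) mx i

  coreOf-antitone : ∀ {I J} → J ⊆ I → coreOf I ⊆ coreOf J
  coreOf-antitone {I} {J} J⊆I mx = coreOf⁺ J (λ k mk → coreOf⁻ I mx k (J⊆I mk))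

  coreOf⊤ : coreOf ⊤ ≡ core F′
  coreOf⊤ = ⊆-antisym
    (λ mx → ∈⋂⁺ F′ (All.tabulate (λ mK → subst (_ ∈_) (sym (lookup-index mK)) (coreOf⁻ ⊤ mx _ ∈⊤))))
    (λ mx → coreOf⁺ ⊤ (λ k _ → All.lookup (∈⋂⁻ F′ mx) (∈-lookup k)))

  short : ∀ I → 1 ≤ ∣ I ∣ → ∣ I ∣ ≤ p → coreOf I ≡ core F′ → SameCoreSubfamily p F′
  short I 1≤∣I∣ ∣I∣≤p eq =
    members I , (λ e → <⇒≢ 1≤∣I∣ (sym (trans (sym (length-tabulate _)) (cong length e)))) ,
    subst (_≤ p) (sym (length-tabulate _)) ∣I∣≤p , tabulate⁺ (λ i → ∈-lookup (enum I i)) , eq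

  irredundant⇒critical : ∀ I → coreOf I ≡ core F′ → p < ∣ I ∣ →
                         (∀ k → k ∈ I → coreOf (I - k) ≢ core F′) → CriticalFamily Fam p q
  irredundant⇒critical I eq p<∣I∣ needed = record
    { member = M ; inFamily = λ j → All.lookup F′⊆Fam (∈-lookup (K j))
    ; large = large ; witness = λ j → proj₁ (wit j)
    ; witness∈ = λ j → proj₁ (proj₂ (wit j)) ; witness∉ = λ j → proj₂ (proj₂ (wit j)) }
    where
    K : Fin (suc p) → Fin m
    K j = enum I (inject≤ j p<∣I∣)
    K∈I : ∀ j → K j ∈ I
    K∈I j = enum∈ I (inject≤ j p<∣I∣)
    K-injective : ∀ {i j} → K i ≡ K j → i ≡ j
    K-injective e = inject≤-injective p<∣I∣ p<∣I∣ _ _ (enum-injective I e)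
    M : Fin (suc p) → Subset n
    M = member ∘ K
    large : ∀ j → q ≤ ∣ coreExcept j M ∣
    large j = F′-intersecting (List.tabulate (M ∘ punchIn j)) (nonempty p≥1)
                (≤-reflexive (length-tabulate _)) (tabulate⁺ (λ i → ∈-lookup (K (punchIn j i))))
      where
      nonempty : 1 ≤ p → List.tabulate (M ∘ punchIn j) ≢ []
      nonempty (s≤s z≤n) ()
    -- K j is needed, so the other members of I leave a point outside M j.
    core⊈ : ∀ j → ¬ (coreOf (I - K j) ⊆ M j)
    core⊈ j ⊆Mj = needed (K j) (K∈I j) (trans (⊆-antisym grow (coreOf-antitone {I} {I - K j} (p─q⊆p I _))) eq)
      where
      grow : coreOf (I - K j) ⊆ coreOf I
      grow {x} mx = coreOf⁺ I λ k mk → case k ≟ K j of λ where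
        (yes refl) → ⊆Mj mx
        (no k≢Kj) → coreOf⁻ (I - K j) mx k (x∈p∧x≢y⇒x∈p-y mk k≢Kj)
    wit : ∀ j → ∃[ x ] (x ∈ coreExcept j M × x ∉ M j)
    wit j with ⊈⇒witness (coreOf (I - K j)) (M j) (core⊈ j)
    ... | x , mx , x∉Mj =
      x , coreExcept⁺ j M (λ i i≢j → coreOf⁻ (I - K j) mx (K i) (x∈p∧x≢y⇒x∈p-y (K∈I i) (i≢j ∘ K-injective))) , x∉Mj

  shrink : ∀ fuel I → coreOf I ≡ core F′ → 1 ≤ ∣ I ∣ → ∣ I ∣ ≤ fuel →
           SameCoreSubfamily p F′ ⊎ CriticalFamily Fam p q
  shrink fuel I eq 1≤∣I∣ ∣I∣≤fuel with ∣ I ∣ ≤? p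
  ... | yes ∣I∣≤p = inj₁ (short I 1≤∣I∣ ∣I∣≤p eq)
  ... | no ∣I∣≰p with any? (λ k → (k ∈? I) ×-dec (coreOf (I - k) ≟ˢ core F′))
  ...   | no none = inj₂ (irredundant⇒critical I eq (≰⇒> ∣I∣≰p) (λ k mk e → none (k , mk , e)))
  shrink zero I eq 1≤∣I∣ ∣I∣≤fuel | no _ | yes _ = absurd (<⇒≱ 1≤∣I∣ ∣I∣≤fuel)
  shrink (suc fuel) I eq 1≤∣I∣ ∣I∣≤fuel | no ∣I∣≰p | yes (k , mk , eq′) =
    shrink fuel (I - k) eq′
      (+-cancelʳ-≤ 1 1 ∣ I - k ∣ (≤-trans (≤-trans (s≤s p≥1) (≰⇒> ∣I∣≰p)) (∣p∣≤∣p-x∣+1 I k)))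
      (≤-pred (≤-trans (x∈p⇒∣p-x∣<∣p∣ mk) ∣I∣≤fuel))

  result : F′ ≢ [] → SameCoreSubfamily p F′ ⊎ CriticalFamily Fam p q
  result ne = shrink m ⊤ coreOf⊤ (subst (1 ≤_) (sym (∣⊤∣≡n m)) (≢[]⇒1≤length F′ ne)) (≤-reflexive (∣⊤∣≡n m))

sameCore-or-critical : ∀ {n} (Fam : Subset n → Set) (p q : ℕ) → 1 ≤ p →
                          (F′ : List (Subset n)) → F′ ≢ [] → All Fam F′ → Intersecting p q F′ →
                          SameCoreSubfamily p F′ ⊎ CriticalFamily Fam p q
sameCore-or-critical Fam p q p≥1 F′ ne F′⊆Fam int = Shrink.result Fam p q p≥1 F′ F′⊆Fam int ne

short⇒missing : ∀ {p} (is : List (Fin (suc p))) → length is ≤ p → ∃[ j ] ¬ (j ∈ₗ is)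
short⇒missing {p} is ∣is∣≤p with any? (λ j → ¬? (Any.any? (j ≟_) is))
... | yes missing = missing
... | no none = absurd (<⇒≱ (s≤s ∣is∣≤p) (injective⇒≤ {f = index ∘ mem} index-injective))
  where
  mem : ∀ j → j ∈ₗ is
  mem j with Any.any? (j ≟_) is
  ... | yes j∈ = j∈
  ... | no j∉ = absurd (none (j , j∉))
  index-injective : Injective _≡_ _≡_ (index ∘ mem)
  index-injective {i} {j} e = trans (lookup-index (mem i)) (trans (cong (List.lookup is) e) (sym (lookup-index (mem j))))

module Critical {n p q : ℕ} {Fam : Subset n → Set} (P : CriticalFamily Fam p q) where
  open CriticalFamily P public

  member-injective : ∀ {i j} → member i ≡ member j → i ≡ j
  member-injective {i} {j} e with i ≟ j
  ... | yes i≡j = i≡j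
  ... | no i≢j = absurd (witness∉ i (subst (_ ∈_) (sym e) (coreExcept⁻ i member (witness∈ i) j (i≢j ∘ sym))))

  family : List (Subset n)
  family = List.tabulate member

  family≢[] : family ≢ []
  family≢[] ()

  family⊆Fam : All Fam family
  family⊆Fam = tabulate⁺ inFamily

  ∈core⁻ : ∀ {x} → x ∈ core family → ∀ j → x ∈ member j
  ∈core⁻ = ∈⋂-tabulate⁻ member

  private
    Indexed : List (Subset n) → Set
    Indexed = All (λ K → ∃[ i ] K ≡ member i)

    indices : ∀ {L} → Indexed L → List (Fin (suc p))
    indices [] = []
    indices ((i , _) ∷ a) = i ∷ indices a

    length-indices : ∀ {L} (a : Indexed L) → length (indices a) ≡ length L
    length-indices [] = refl
    length-indices (_ ∷ a) = cong suc (length-indices a)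

    avoid : ∀ {L j x} (a : Indexed L) → ¬ (j ∈ₗ indices a) → x ∈ coreExcept j member → All (x ∈_) L
    avoid [] _ _ = []
    avoid ((i , refl) ∷ a) j∉ mx = coreExcept⁻ _ member mx i (j∉ ∘ here ∘ sym) ∷ avoid a (j∉ ∘ there) mx

  -- p members miss some index j, so their core contains coreExcept j.
  coreExcept⊆core : ∀ L → length L ≤ p → All (_∈ₗ family) L → ∃[ j ] (coreExcept j member ⊆ ⋂ L)
  coreExcept⊆core L ∣L∣≤p L⊆ with short⇒missing (indices L⊆′) (subst (_≤ p) (sym (length-indices L⊆′)) ∣L∣≤p)
    where
    L⊆′ : Indexed L
    L⊆′ = All.map ∈-tabulate⁻ L⊆
  ... | j , j∉ = j , λ mx → ∈⋂⁺ L (avoid (All.map ∈-tabulate⁻ L⊆) j∉ mx)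

  intersecting : Intersecting p q family
  intersecting L _ ∣L∣≤p L⊆ with coreExcept⊆core L ∣L∣≤p L⊆
  ... | j , ⊆L = ≤-trans (large j) (p⊆q⇒∣p∣≤∣q∣ ⊆L)

  ¬strongHelly : ¬ StrongHelly p q Fam
  ¬strongHelly sh with sh family family≢[] family⊆Fam intersecting
  ... | L , _ , ∣L∣≤p , L⊆ , e with coreExcept⊆core L ∣L∣≤p L⊆
  ...   | j , ⊆L = witness∉ j (∈core⁻ (subst (_ ∈_) e (⊆L (witness∈ j))) j)

  core⊂coreExcept : ∀ j → core family ⊂ coreExcept j member
  core⊂coreExcept j = (λ mx → coreExcept⁺ j member (λ i _ → ∈core⁻ mx i)) ,
                      witness j , witness∈ j , (λ mx → witness∉ j (∈core⁻ mx j))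

  -- A larger intersection size that the family still satisfies but its core does not.
  q⁺ : ℕ
  q⁺ = q ⊔ suc ∣ core family ∣

  ¬helly⁺ : ¬ HellyProperty p q⁺ Fam
  ¬helly⁺ h = <⇒≱ (m≤n⊔m q _) (h family family≢[] family⊆Fam intersecting⁺)
    where
    intersecting⁺ : Intersecting p q⁺ family
    intersecting⁺ L _ ∣L∣≤p L⊆ with coreExcept⊆core L ∣L∣≤p L⊆
    ... | j , ⊆L = ≤-trans (⊔-lub (large j) (p⊂q⇒∣p∣<∣q∣ (core⊂coreExcept j))) (p⊆q⇒∣p∣≤∣q∣ ⊆L)

¬critical⇒strongHelly : ∀ {n p q} (Fam : Subset n → Set) → 1 ≤ p → ¬ CriticalFamily Fam p q → StrongHelly p q Fam
¬critical⇒strongHelly {p = p} {q} Fam p≥1 ¬critical F′ ne F′⊆Fam int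
  with sameCore-or-critical Fam p q p≥1 F′ ne F′⊆Fam int
... | inj₁ short = short
... | inj₂ P = absurd (¬critical P)

strongHelly⇒helly : ∀ {n p q} {Fam : Subset n → Set} → StrongHelly p q Fam → HellyProperty p q Fam
strongHelly⇒helly {q = q} sh F′ ne F′⊆Fam int with sh F′ ne F′⊆Fam int
... | L , L≢[] , ∣L∣≤p , L⊆ , e = subst (λ C → q ≤ ∣ C ∣) e (int L L≢[] ∣L∣≤p L⊆)

strongHelly-mono : ∀ {n p q q′} {Fam : Subset n → Set} → q ≤ q′ → StrongHelly p q Fam → StrongHelly p q′ Fam
strongHelly-mono q≤q′ sh F′ ne F′⊆Fam int = sh F′ ne F′⊆Fam (λ L L≢[] ∣L∣≤p L⊆ → ≤-trans q≤q′ (int L L≢[] ∣L∣≤p L⊆))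

-- Cliques

module _ {n : ℕ} (G : Graph n) where

  adj? : ∀ u v → Dec (Adj G u v)
  adj? u v = adj G u v ≟b true

  adj-sym : ∀ {u v} → Adj G u v → Adj G v u
  adj-sym {u} {v} e = trans (gsym G v u) e

  complete? : ∀ u (W : Subset n) → Dec (Complete G u W)
  complete? u W with all? (λ w → (w ∈? W) →-dec (¬? (w ≟ u) →-dec adj? u w))
  ... | yes h = yes (λ w m ne → h w m ne)
  ... | no h = no (λ c → h (λ w m ne → c w m ne))

  anticomplete? : ∀ u (W : Subset n) → Dec (Anticomplete G u W)
  anticomplete? u W with all? (λ w → (w ∈? W) →-dec (¬? (w ≟ u) →-dec (adj G u w ≟b false)))
  ... | yes h = yes (λ w m ne → h w m ne)
  ... | no h = no (λ c → h (λ w m ne → c w m ne))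

  clique? : (C : Subset n) → Dec (IsClique G C)
  clique? C with all? (λ u → all? (λ v → (u ∈? C) →-dec ((v ∈? C) →-dec (¬? (u ≟ v) →-dec adj? u v))))
  ... | yes h = yes (λ u v mu mv ne → h u v mu mv ne)
  ... | no h = no (λ c → h (λ u v mu mv ne → c u v mu mv ne))

  clique-⊆ : ∀ {C D} → C ⊆ D → IsClique G D → IsClique G C
  clique-⊆ C⊆D cD u v mu mv ne = cD u v (C⊆D mu) (C⊆D mv) ne

  clique-∪⁅⁆ : ∀ {C v} → IsClique G C → Complete G v C → IsClique G (C ∪ ⁅ v ⁆)
  clique-∪⁅⁆ {C} cC vC a b ma mb a≢b with ∈∪⁅⁆⁻ C ma | ∈∪⁅⁆⁻ C mb
  ... | inj₁ a∈C | inj₁ b∈C = cC a b a∈C b∈C a≢b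
  ... | inj₁ a∈C | inj₂ refl = adj-sym (vC a a∈C a≢b)
  ... | inj₂ refl | inj₁ b∈C = vC b b∈C (a≢b ∘ sym)
  ... | inj₂ refl | inj₂ refl = absurd (a≢b refl)

  closedNbhd : Fin n → Subset n
  closedNbhd u = tabulate (λ x → does (x ≟ u) ∨ adj G u x)

  closedNbhd∋ : ∀ u → u ∈ closedNbhd u
  closedNbhd∋ u = ∈tabulate⁺ _ (cong (_∨ adj G u u) (dec-true (u ≟ u) refl))

  ∈closedNbhd⁺ : ∀ {u x} → Adj G u x → x ∈ closedNbhd u
  ∈closedNbhd⁺ {u} {x} a = ∈tabulate⁺ _ (trans (cong (does (x ≟ u) ∨_) a) (∨-zeroʳ _))

  ∈closedNbhd⁻ : ∀ {u x} → x ∈ closedNbhd u → x ≡ u ⊎ Adj G u x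
  ∈closedNbhd⁻ {u} {x} m with x ≟ u | ∈tabulate⁻ (λ x → does (x ≟ u) ∨ adj G u x) m
  ... | yes x≡u | _ = inj₁ x≡u
  ... | no _ | a = inj₂ a

  nonNeighbour : ∀ {K v} → MaximalClique G K → v ∉ K → ∃[ u ] (u ∈ K × u ≢ v × adj G v u ≡ false)
  nonNeighbour {K} {v} (cK , maxK) v∉K with any? (λ u → (u ∈? K) ×-dec ¬? (u ≟ v) ×-dec (adj G v u ≟b false))
  ... | yes found = found
  ... | no none = absurd (v∉K (maxK (K ∪ ⁅ v ⁆) (clique-∪⁅⁆ cK complete) (p⊆p∪q _) (x∈p∪q⁺ (inj₂ (x∈⁅x⁆ v)))))
    where
    complete : Complete G v K
    complete u mu u≢v with adj G v u in eq
    ... | true = refl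
    ... | false = absurd (none (u , mu , u≢v , eq))

  extendWithin : ∀ k (C : Subset n) → IsClique G C → n ≤ ∣ C ∣ + k →
                 Σ[ K ∈ Subset n ] (MaximalClique G K × C ⊆ K)
  extendWithin k C cC bound with any? (λ v → ¬? (v ∈? C) ×-dec clique? (C ∪ ⁅ v ⁆))
  ... | no none = C , (cC , maximal) , id
    where
    maximal : ∀ C′ → IsClique G C′ → C ⊆ C′ → C′ ⊆ C
    maximal C′ cC′ C⊆C′ {x} mx with x ∈? C
    ... | yes x∈C = x∈C
    ... | no x∉C = absurd (none (x , x∉C , clique-⊆ (∪-⊆ C⊆C′ (⁅⁆-⊆ mx)) cC′))
  extendWithin zero C cC bound | yes (v , v∉C , _) =
    absurd (<⇒≱ (subst (n <_) (sym (∣p∪⁅x⁆∣≡1+∣p∣ C v∉C)) (s≤s (subst (n ≤_) (+-identityʳ _) bound)))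
                (∣p∣≤n (C ∪ ⁅ v ⁆)))
  extendWithin (suc k) C cC bound | yes (v , v∉C , cC′)
    with extendWithin k (C ∪ ⁅ v ⁆) cC′
           (subst (λ m → n ≤ m + k) (sym (∣p∪⁅x⁆∣≡1+∣p∣ C v∉C)) (subst (n ≤_) (+-suc ∣ C ∣ k) bound))
  ... | K , maxK , ⊆K = K , maxK , (λ m → ⊆K (p⊆p∪q _ m))

  extendToMaximal : (C : Subset n) → IsClique G C → Σ[ K ∈ Subset n ] (MaximalClique G K × C ⊆ K)
  extendToMaximal C cC = extendWithin n C cC (m≤n+m n ∣ C ∣)

induced : ∀ {n} (G : Graph n) (X : Subset n) → Graph ∣ X ∣
induced G X = record { adj = λ a b → adj G (enum X a) (enum X b) ; sym = λ a b → gsym G _ _ ; irrefl = λ a → girrefl G _ }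

induced-embedding : ∀ {n} (G : Graph n) (X : Subset n) → InducedEmbedding (induced G X) G (enum X)
induced-embedding G X = enum-injective X , (λ i j → refl)

critical-induced : ∀ {k n p q} {H : Graph k} {G : Graph n} {f : Fin k → Fin n} →
                   InducedEmbedding H G f → CriticalCliques H p q → CriticalCliques G p q
critical-induced {n = n} {p} {q} {H} {G} {f} (f-injective , f-adj) P = record
  { member = M′ ; inFamily = maximal ; large = large′ ; witness = f ∘ witness
  ; witness∈ = λ j → toCoreExcept j (witness∈ j) ; witness∉ = witness∉′ }
  where
  open Critical P
  imageClique : ∀ j → IsClique G (image f (member j))
  imageClique j u v mu mv u≢v with image⁻ f (member j) mu | image⁻ f (member j) mv
  ... | a , ma , refl | b , mb , refl = trans (sym (f-adj a b)) (proj₁ (inFamily j) a b ma mb (u≢v ∘ cong f))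
  extended : ∀ j → Σ[ K ∈ Subset n ] (MaximalClique G K × image f (member j) ⊆ K)
  extended j = extendToMaximal G _ (imageClique j)
  M′ : Fin (suc p) → Subset n
  M′ j = proj₁ (extended j)
  maximal : ∀ j → MaximalClique G (M′ j)
  maximal j = proj₁ (proj₂ (extended j))
  ⊆M′ : ∀ j {z} → z ∈ member j → f z ∈ M′ j
  ⊆M′ j m = proj₂ (proj₂ (extended j)) (image⁺ f (member j) m)
  toCoreExcept : ∀ j {x} → x ∈ coreExcept j member → f x ∈ coreExcept j M′
  toCoreExcept j mx = coreExcept⁺ j M′ (λ i i≢j → ⊆M′ i (coreExcept⁻ j member mx i i≢j))
  large′ : ∀ j → q ≤ ∣ coreExcept j M′ ∣
  large′ j = ≤-trans (large j) (injective⇒∣p∣≤∣q∣ _ _ f (toCoreExcept j) (λ _ _ → f-injective))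
  -- Otherwise the vertices that f sends into M′ j would form a clique of H
  -- strictly larger than member j.
  witness∉′ : ∀ j → f (witness j) ∉ M′ j
  witness∉′ j fw∈ = witness∉ j (proj₂ (inFamily j) _ clique (p⊆p∪q _) (x∈p∪q⁺ (inj₂ (x∈⁅x⁆ (witness j)))))
    where
    into : ∀ {z} → z ∈ member j ∪ ⁅ witness j ⁆ → f z ∈ M′ j
    into m with ∈∪⁅⁆⁻ (member j) m
    ... | inj₁ mz = ⊆M′ j mz
    ... | inj₂ refl = fw∈
    clique : IsClique H (member j ∪ ⁅ witness j ⁆)
    clique a b ma mb a≢b = trans (f-adj a b) (proj₁ (maximal j) (f a) (f b) (into ma) (into mb) (a≢b ∘ f-injective))

¬critical⇒cliqueHelly : ∀ {k p q} (H : Graph k) → 1 ≤ p → ¬ CriticalCliques H p q → CliqueHelly p q H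
¬critical⇒cliqueHelly H p≥1 ¬critical = strongHelly⇒helly (¬critical⇒strongHelly (MaximalClique H) p≥1 ¬critical)

module _ {n : ℕ} (p q : ℕ) (p≥1 : 1 ≤ p) (G : Graph n) where
  open Conditions p q G

  ¬critical⇒i : ¬ CriticalCliques G p q → cond-i
  ¬critical⇒i ¬critical k H f emb = ¬critical⇒cliqueHelly H p≥1 (¬critical ∘ critical-induced {H = H} {G = G} emb)

  ii⇔¬critical : cond-ii ⇔ (¬ CriticalCliques G p q)
  ii⇔¬critical = mk⇔
    (λ ii P → Critical.¬helly⁺ P (ii _ (m≤m⊔n q _)))
    (λ ¬critical q′ q≤q′ → strongHelly⇒helly (strongHelly-mono q≤q′ (¬critical⇒strongHelly _ p≥1 ¬critical)))

  iii⇔¬critical : cond-iii ⇔ (¬ CriticalCliques G p q)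
  iii⇔¬critical = mk⇔ (λ iii P → Critical.¬strongHelly P iii) (¬critical⇒strongHelly _ p≥1)

  iv⇔¬critical : cond-iv ⇔ (¬ CriticalCliques G p q)
  iv⇔¬critical = mk⇔
    (λ iv P → let open Critical P in
      Critical.¬strongHelly (indexed P) (iv member inFamily (λ {i} {j} → member-injective {i} {j})))
    (λ ¬critical K maximal _ →
      ¬critical⇒strongHelly (FamilyOf K) p≥1 (¬critical ∘ critical-map (λ { (i , refl) → maximal i })))
    where
    indexed : (P : CriticalCliques G p q) → CriticalFamily (FamilyOf (CriticalFamily.member P)) p q
    indexed P = record
      { member = member ; inFamily = λ j → j , refl ; large = large
      ; witness = witness ; witness∈ = witness∈ ; witness∉ = witness∉ }
      where open CriticalFamily P

-- J-configurations

thirdIndex : ∀ {p} → 2 ≤ p → (a b : Fin (suc p)) → ∃[ k ] (k ≢ a × k ≢ b)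
thirdIndex {suc zero} (s≤s ()) a b
thirdIndex {suc (suc p)} _ a b with punchIn a zero ≟ b
... | no ne = punchIn a zero , punchInᵢ≢i a zero , ne
... | yes e = punchIn a (suc zero) , punchInᵢ≢i a (suc zero) ,
              (λ e′ → 0≢1+n (punchIn-injective a zero (suc zero) (trans e (sym e′))))

-- The vertex set U = S ∪ T 0 ∪ … ∪ T p of a J-configuration or an ocular.
module Blocks {n p : ℕ} (S : Subset n) (T : Fin (suc p) → Subset n)
              (S-T-disjoint : ∀ i → Empty (S ∩ T i)) (T-disjoint : PairwiseDisjoint T) where

  U : Subset n
  U = S ∪ ⋃ᶠ T

  U⁻ : ∀ {x} → x ∈ U → x ∈ S ⊎ ∃[ i ] x ∈ T i
  U⁻ m with x∈p∪q⁻ S (⋃ᶠ T) m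
  ... | inj₁ mS = inj₁ mS
  ... | inj₂ m⋃ = inj₂ (⋃ᶠ⁻ T m⋃)

  S⊆U : S ⊆ U
  S⊆U m = x∈p∪q⁺ (inj₁ m)

  T⊆U : ∀ i → T i ⊆ U
  T⊆U i m = x∈p∪q⁺ (inj₂ (⋃ᶠ⁺ T i m))

  S⊆U─T : ∀ k → S ⊆ U ─ T k
  S⊆U─T k m = x∈p∧x∉q⇒x∈p─q (S⊆U m) (λ m′ → S-T-disjoint k (_ , x∈p∩q⁺ (m , m′)))

  T⊆U─T : ∀ k j → j ≢ k → T j ⊆ U ─ T k
  T⊆U─T k j j≢k m = x∈p∧x∉q⇒x∈p─q (T⊆U j m) (λ m′ → T-disjoint j k j≢k (_ , x∈p∩q⁺ (m , m′)))

  ∈U─T : ∀ {x} → x ∈ U → Σ[ g ∈ Fin (suc p) ] (∀ k → k ≢ g → x ∈ U ─ T k)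
  ∈U─T m with U⁻ m
  ... | inj₁ mS = zero , (λ k _ → S⊆U─T k mS)
  ... | inj₂ (j , mj) = j , (λ k k≢j → T⊆U─T k j (k≢j ∘ sym) mj)

  -- Any two vertices of U avoid a common third T k.
  clique-from-sides : ∀ (G : Graph n) → 2 ≤ p → (∀ i → IsClique G (U ─ T i)) → IsClique G U
  clique-from-sides G p≥2 cl a b ma mb a≢b with ∈U─T ma | ∈U─T mb
  ... | ga , ha | gb , hb with thirdIndex p≥2 ga gb
  ...   | k , k≢ga , k≢gb = cl k a b (ha k k≢ga) (hb k k≢gb) a≢b

  ∣U∣≡ : ∀ {s t} → ∣ S ∣ ≡ s → (∀ i → ∣ T i ∣ ≡ t) → ∣ U ∣ ≡ suc p * t + s
  ∣U∣≡ {s} {t} ∣S∣≡s ∣T∣≡t =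
    trans (∣p∪q∣≡∣p∣+∣q∣ S (⋃ᶠ T) disjoint) (trans (cong₂ _+_ ∣S∣≡s (∣⋃ᶠ∣≡ T t T-disjoint ∣T∣≡t)) (+-comm s _))
    where
    disjoint : Empty (S ∩ ⋃ᶠ T)
    disjoint (x , m) with ⋃ᶠ⁻ T (proj₂ (x∈p∩q⁻ S _ m))
    ... | i , mi = S-T-disjoint i (x , x∈p∩q⁺ (proj₁ (x∈p∩q⁻ S _ m) , mi))

outsideOthers : ∀ {n p} (U : Subset n) (T : Fin (suc p) → Subset n) → Fin (suc p) → Subset n
outsideOthers U T i = U ─ ⋃ᶠ (T ∘ punchIn i)

outsideOthers⁻ : ∀ {n p} (U : Subset n) (T : Fin (suc p) → Subset n) i {x} → x ∈ outsideOthers U T i →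
                 x ∈ U × (∀ j → j ≢ i → x ∉ T j)
outsideOthers⁻ U T i {x} m = proj₁ (∈─⁻ U _ m) , λ j j≢i mj →
  proj₂ (∈─⁻ U _ m) (⋃ᶠ⁺ (T ∘ punchIn i) (punchOut (j≢i ∘ sym)) (subst (λ k → x ∈ T k) (sym (punchIn-punchOut (j≢i ∘ sym))) mj))

-- Stated with both sides moved so that no subtraction occurs.
[1+p]t+s≤Q+X⇒t+s≤Q : ∀ p t s Q X → suc p * t + s ≤ Q + X → X ≤ p * t → t + s ≤ Q
[1+p]t+s≤Q+X⇒t+s≤Q p t s Q X h X≤pt =
  +-cancelʳ-≤ (p * t) (t + s) Q (subst (_≤ Q + p * t) eq (≤-trans h (+-monoʳ-≤ Q X≤pt)))
  where
  open +-*-Solver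
  eq : suc p * t + s ≡ t + s + p * t
  eq = solve 3 (λ p t s → (con 1 :+ p) :* t :+ s := t :+ s :+ p :* t) refl p t s

q≤∣outsideOthers∣ : ∀ {n p q s} (U : Subset n) (T : Fin (suc p) → Subset n) i → s < q → Jsize p q s ≤ ∣ U ∣ →
                    (∀ j → ∣ T j ∣ ≡ q ∸ s) → q ≤ ∣ outsideOthers U T i ∣
q≤∣outsideOthers∣ {p = p} {q} {s} U T i s<q Jsize≤∣U∣ ∣T∣≡q∸s =
  subst (_≤ ∣ outsideOthers U T i ∣) (m∸n+n≡m (<⇒≤ s<q))
    ([1+p]t+s≤Q+X⇒t+s≤Q p (q ∸ s) s _ _ (≤-trans Jsize≤∣U∣ (∣p∣≤∣p─q∣+∣q∣ U _))
      (∣⋃ᶠ∣≤ (T ∘ punchIn i) (q ∸ s) (≤-reflexive ∘ ∣T∣≡q∸s ∘ punchIn i)))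

-- If, seen through the injection c, the member K i contains U ─ T i but misses a
-- point of T i, then the K i form a critical family: the common part of all K j
-- with j ≢ i contains the image of the at least q points of U outside those T j.
covering⇒critical : ∀ {m n p q s} {Fam : Subset n → Set} (c : Fin m → Fin n) → Injective _≡_ _≡_ c →
                    s < q → (U : Subset m) → Jsize p q s ≤ ∣ U ∣ →
                    (T : Fin (suc p) → Subset m) → PairwiseDisjoint T → (∀ i → T i ⊆ U) → (∀ i → ∣ T i ∣ ≡ q ∸ s) →
                    (K : Fin (suc p) → Subset n) → (∀ i → Fam (K i)) →
                    (∀ i {x} → x ∈ U ─ T i → c x ∈ K i) → (∀ i → ∃[ y ] (y ∈ T i × c y ∉ K i)) →
                    CriticalFamily Fam p q
covering⇒critical c c-injective s<q U Jsize≤∣U∣ T T-disjoint T⊆U ∣T∣≡q∸s K inFamily U─T⊆K missed = record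
  { member = K ; inFamily = inFamily
  ; large = λ i → ≤-trans (q≤∣outsideOthers∣ U T i s<q Jsize≤∣U∣ ∣T∣≡q∸s)
                          (injective⇒∣p∣≤∣q∣ _ _ c (outside⊆ i) (λ _ _ → c-injective))
  ; witness = λ i → c (proj₁ (missed i))
  ; witness∈ = λ i → let (y , y∈T , _) = missed i in
      coreExcept⁺ i K (λ j j≢i → U─T⊆K j (x∈p∧x∉q⇒x∈p─q (T⊆U i y∈T) (λ y∈Tj → T-disjoint i j (j≢i ∘ sym) (y , x∈p∩q⁺ (y∈T , y∈Tj)))))
  ; witness∉ = λ i → proj₂ (proj₂ (missed i)) }
  where
  outside⊆ : ∀ i {x} → x ∈ outsideOthers U T i → c x ∈ coreExcept i K
  outside⊆ i m = let (x∈U , x∉T) = outsideOthers⁻ U T i m in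
    coreExcept⁺ i K (λ j j≢i → U─T⊆K j (x∈p∧x∉q⇒x∈p─q x∈U (x∉T j j≢i)))

Spoiled : ∀ {n p} → Graph n → Subset n → (Fin (suc p) → Subset n) → Set
Spoiled {n} G U T = ∀ i v → v ∈ T i → ∃[ u ] (u ≢ v × Complete G u (U ─ T i) × adj G v u ≡ false)

-- A copy of J_{p+1,q,s} in the clique matrix: the maximal clique K i contains
-- S and every T j but T i.
record JConfig {n : ℕ} (G : Graph n) (p q : ℕ) : Set where
  field
    s            : ℕ
    s<q          : s < q
    S            : Subset n
    T            : Fin (suc p) → Subset n
    K            : Fin (suc p) → Subset n
    ∣S∣≡s        : ∣ S ∣ ≡ s
    ∣T∣≡q∸s      : ∀ i → ∣ T i ∣ ≡ q ∸ s
    S-T-disjoint : ∀ i → Empty (S ∩ T i)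
    T-disjoint   : PairwiseDisjoint T
    K-maximal    : ∀ i → MaximalClique G (K i)
    S⊆K          : ∀ i → S ⊆ K i
    T⊆K          : ∀ i j → j ≢ i → T j ⊆ K i
    T-K-disjoint : ∀ i → Empty (T i ∩ K i)

  open Blocks S T S-T-disjoint T-disjoint public

  U─T⊆K : ∀ i → U ─ T i ⊆ K i
  U─T⊆K i m with ∈─⁻ U (T i) m
  ... | x∈U , x∉Ti with U⁻ x∈U
  ...   | inj₁ x∈S = S⊆K i x∈S
  ...   | inj₂ (j , x∈Tj) with j ≟ i
  ...     | yes refl = absurd (x∉Ti x∈Tj)
  ...     | no j≢i = T⊆K i j j≢i x∈Tj

  ∣U∣≡Jsize : ∣ U ∣ ≡ Jsize p q s
  ∣U∣≡Jsize = ∣U∣≡ ∣S∣≡s ∣T∣≡q∸s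

  T∉K : ∀ i {v} → v ∈ T i → v ∉ K i
  T∉K i v∈T v∈K = T-K-disjoint i (_ , x∈p∩q⁺ (v∈T , v∈K))

  -- v ∈ T i has a non-neighbour in K i, which is complete to U ─ T i ⊆ K i.
  spoiled : Spoiled G U T
  spoiled i v v∈T with nonNeighbour G (K-maximal i) (T∉K i v∈T)
  ... | u , u∈K , u≢v , nonadjacent =
    u , u≢v , (λ w w∈ w≢u → proj₁ (K-maximal i) u w u∈K (U─T⊆K i w∈) (w≢u ∘ sym)) , nonadjacent

-- s = min d (q ∸ 1): then s points fit in a set of size d, and q ∸ s points fit in
-- any nonempty set of size a with q ≤ d + a.
sharedSize : ∀ d q → 1 ≤ q → Σ[ s ∈ ℕ ] (s < q × s ≤ d × (∀ a → q ≤ d + a → 1 ≤ a → q ∸ s ≤ a))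
sharedSize d (suc q) _ with d ≤? q
... | yes d≤q = d , s≤s d≤q , ≤-reflexive refl , (λ a h _ → m≤n+o⇒m∸n≤o (suc q) d h)
... | no d≰q = q , ≤-reflexive refl , <⇒≤ (≰⇒> d≰q) , (λ a _ 1≤a → subst (_≤ a) (sym (m+n∸n≡m 1 q)) 1≤a)

-- Take for S up to q ∸ 1 points of the common core D, and for T j points of the
-- core of the other members outside M j.
critical⇒JConfig : ∀ {n p q} (G : Graph n) → 1 ≤ q → CriticalCliques G p q → JConfig G p q
critical⇒JConfig {n} {p} {q} G q≥1 P = record
  { s = s ; s<q = s<q ; S = S ; T = T ; K = member
  ; ∣S∣≡s = proj₂ (proj₂ chosenS) ; ∣T∣≡q∸s = λ i → proj₂ (proj₂ (chosenT i))
  ; S-T-disjoint = λ i (x , m) → proj₂ (∈─⁻ _ _ (T⊆A i (proj₂ (x∈p∩q⁻ S _ m)))) (S⊆member i (proj₁ (x∈p∩q⁻ S _ m)))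
  ; T-disjoint = λ i j i≢j (x , m) →
      proj₂ (∈─⁻ _ _ (T⊆A j (proj₂ (x∈p∩q⁻ (T i) _ m))))
            (coreExcept⁻ i member (proj₁ (∈─⁻ _ _ (T⊆A i (proj₁ (x∈p∩q⁻ (T i) _ m))))) j (i≢j ∘ sym))
  ; K-maximal = inFamily ; S⊆K = S⊆member
  ; T⊆K = λ i j j≢i m → coreExcept⁻ j member (proj₁ (∈─⁻ _ _ (T⊆A j m))) i (j≢i ∘ sym)
  ; T-K-disjoint = λ i (x , m) → proj₂ (∈─⁻ _ _ (T⊆A i (proj₁ (x∈p∩q⁻ (T i) _ m)))) (proj₂ (x∈p∩q⁻ (T i) _ m)) }
  where
  open Critical P
  D : Subset n
  D = core family
  A : Fin (suc p) → Subset n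
  A j = coreExcept j member ─ member j
  q≤∣D∣+∣A∣ : ∀ j → q ≤ ∣ D ∣ + ∣ A j ∣
  q≤∣D∣+∣A∣ j = ≤-trans (large j) (≤-trans (p⊆q⇒∣p∣≤∣q∣ split) (∣p∪q∣≤∣p∣+∣q∣ D (A j)))
    where
    split : coreExcept j member ⊆ D ∪ A j
    split {x} mx with x ∈? member j
    ... | yes x∈Mj = x∈p∪q⁺ (inj₁ (∈⋂-tabulate⁺ member λ i → case i ≟ j of λ where
            (yes refl) → x∈Mj
            (no i≢j) → coreExcept⁻ j member mx i i≢j))
    ... | no x∉Mj = x∈p∪q⁺ (inj₂ (x∈p∧x∉q⇒x∈p─q mx x∉Mj))
  1≤∣A∣ : ∀ j → 1 ≤ ∣ A j ∣
  1≤∣A∣ j = ∈⇒1≤∣p∣ (x∈p∧x∉q⇒x∈p─q (witness∈ j) (witness∉ j))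
  chooseS : Σ[ s ∈ ℕ ] (s < q × s ≤ ∣ D ∣ × (∀ a → q ≤ ∣ D ∣ + a → 1 ≤ a → q ∸ s ≤ a))
  chooseS = sharedSize ∣ D ∣ q q≥1
  s : ℕ
  s = proj₁ chooseS
  s<q : s < q
  s<q = proj₁ (proj₂ chooseS)
  chosenS : Σ[ Y ∈ Subset n ] (Y ⊆ D × ∣ Y ∣ ≡ s)
  chosenS = subsetOfSize D s (proj₁ (proj₂ (proj₂ chooseS)))
  S : Subset n
  S = proj₁ chosenS
  S⊆member : ∀ i → S ⊆ member i
  S⊆member i m = ∈⋂-tabulate⁻ member (proj₁ (proj₂ chosenS) m) i
  chosenT : ∀ j → Σ[ Y ∈ Subset n ] (Y ⊆ A j × ∣ Y ∣ ≡ q ∸ s)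
  chosenT j = subsetOfSize (A j) (q ∸ s) (proj₂ (proj₂ (proj₂ chooseS)) ∣ A j ∣ (q≤∣D∣+∣A∣ j) (1≤∣A∣ j))
  T : Fin (suc p) → Subset n
  T j = proj₁ (chosenT j)
  T⊆A : ∀ j → T j ⊆ A j
  T⊆A j = proj₁ (proj₂ (chosenT j))

module _ {n : ℕ} (p q : ℕ) (G : Graph n) where
  open Conditions p q G

  jconfig⇒¬vii : JConfig G p q → ¬ cond-vii
  jconfig⇒¬vii J vii with vii s s<q U ∣U∣≡Jsize T T-disjoint T⊆U ∣T∣≡q∸s (λ i → clique-⊆ G (U─T⊆K i) (proj₁ (K-maximal i)))
    where open JConfig J
  ... | i , v , v∈T , adjacentToComplete with JConfig.spoiled J i v v∈T
  ...   | u , u≢v , complete , nonadjacent = true≢false (trans (sym (adjacentToComplete u u≢v complete)) nonadjacent)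

  ¬critical⇒vii : ¬ CriticalCliques G p q → cond-vii
  ¬critical⇒vii ¬critical s s<q U ∣U∣≡Jsize T T-disjoint T⊆U ∣T∣≡q∸s cliques
    with any? (λ i → any? (λ v → (v ∈? T i) ×-dec
                 all? (λ u → ¬? (u ≟ v) →-dec (complete? G u (U ─ T i) →-dec adj? G v u))))
  ... | yes (i , v , v∈T , good) = i , v , v∈T , (λ u u≢v → good u u≢v)
  ... | no none = absurd (¬critical (covering⇒critical id id s<q U (≤-reflexive (sym ∣U∣≡Jsize)) T T-disjoint T⊆U ∣T∣≡q∸s
                                        M (λ i → proj₁ (proj₂ (extended i))) (λ i m → U─T⊆M i m) missed))
    where
    v : Fin (suc p) → Fin n
    v i = proj₁ (q∸s-sized⇒Nonempty (T i) s<q (∣T∣≡q∸s i))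
    v∈T : ∀ i → v i ∈ T i
    v∈T i = proj₂ (q∸s-sized⇒Nonempty (T i) s<q (∣T∣≡q∸s i))
    -- No vertex of T i is adjacent to all vertices complete to U ─ T i.
    spoiler : ∀ i → ∃[ u ] (u ≢ v i × Complete G u (U ─ T i) × ¬ Adj G (v i) u)
    spoiler i with ¬∀⟶∃¬ n _ (λ u → ¬? (u ≟ v i) →-dec (complete? G u (U ─ T i) →-dec adj? G (v i) u))
                     (λ h → none (i , v i , v∈T i , h))
    ... | u , bad with u ≟ v i | complete? G u (U ─ T i) | adj? G (v i) u
    ...   | yes u≡v | _ | _ = absurd (bad (λ u≢v → absurd (u≢v u≡v)))
    ...   | no _ | no ¬complete | _ = absurd (bad (λ _ complete → absurd (¬complete complete)))
    ...   | no _ | yes _ | yes adjacent = absurd (bad (λ _ _ → adjacent))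
    ...   | no u≢v | yes complete | no ¬adjacent = u , u≢v , complete , ¬adjacent
    u : Fin (suc p) → Fin n
    u i = proj₁ (spoiler i)
    extended : ∀ i → Σ[ K ∈ Subset n ] (MaximalClique G K × (U ─ T i) ∪ ⁅ u i ⁆ ⊆ K)
    extended i = extendToMaximal G _ (clique-∪⁅⁆ G (cliques i) (proj₁ (proj₂ (proj₂ (spoiler i)))))
    M : Fin (suc p) → Subset n
    M i = proj₁ (extended i)
    U─T⊆M : ∀ i → U ─ T i ⊆ M i
    U─T⊆M i m = proj₂ (proj₂ (extended i)) (x∈p∪q⁺ (inj₁ m))
    missed : ∀ i → ∃[ y ] (y ∈ T i × y ∉ M i)
    missed i = v i , v∈T i , λ v∈M → proj₂ (proj₂ (proj₂ (spoiler i)))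
      (proj₁ (proj₁ (proj₂ (extended i))) (v i) (u i) v∈M (proj₂ (proj₂ (extended i)) (x∈p∪q⁺ (inj₂ (x∈⁅x⁆ (u i)))))
             (proj₁ (proj₂ (spoiler i)) ∘ sym))

  jconfig⇒containsJ : (J : JConfig G p q) → CliqueMatrixContainsJ G p q (JConfig.s J)
  jconfig⇒containsJ J = containsJ (Jsize p q s) ∣U∣≡Jsize
    where
    open JConfig J
    K-injective : ∀ {i j} → K i ≡ K j → i ≡ j
    K-injective {i} {j} e with i ≟ j
    ... | yes i≡j = i≡j
    ... | no i≢j with q∸s-sized⇒Nonempty (T i) s<q (∣T∣≡q∸s i)
    ...   | y , y∈T = absurd (T∉K i y∈T (subst (y ∈_) (sym e) (T⊆K j i i≢j y∈T)))
    -- Generalised over the size of U so that ∣ U ∣ ≡ Jsize p q s can be matched.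
    containsJ : ∀ m → ∣ U ∣ ≡ m →
      Σ[ T′ ∈ (Fin (suc p) → Subset m) ] ((PairwiseDisjoint T′ × (∀ i → ∣ T′ i ∣ ≡ q ∸ s)) ×
      Σ[ r ∈ (Fin (suc p) → Subset n) ] ((∀ i → MaximalClique G (r i)) × Injective _≡_ _≡_ r ×
      Σ[ c ∈ (Fin m → Fin n) ] (Injective _≡_ _≡_ c × (∀ i j → (c j ∈ r i) ⇔ (j ∉ T′ i)))))
    containsJ .(∣ U ∣) refl =
      T′ , (restrict-disjoint U T-disjoint , λ i → trans (∣restrict∣≡∣p∣ U (T i) (T⊆U i)) (∣T∣≡q∸s i)) ,
      K , K-maximal , K-injective , enum U , enum-injective U ,
      (λ i j → mk⇔ (λ j∈K j∈T′ → T∉K i (restrict∈⁻ U (T i) j∈T′) j∈K)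
                   (λ j∉T′ → U─T⊆K i (x∈p∧x∉q⇒x∈p─q (enum∈ U j) (j∉T′ ∘ restrict∈⁺ U (T i)))))
      where
      T′ : Fin (suc p) → Subset ∣ U ∣
      T′ i = restrict U (T i)

  ¬critical⇒vi : ¬ CriticalCliques G p q → cond-vi
  ¬critical⇒vi ¬critical s s<q (T , (T-disjoint , ∣T∣≡q∸s) , r , r-maximal , _ , c , c-injective , entry) =
    ¬critical (covering⇒critical c c-injective s<q ⊤ (≤-reflexive (sym (∣⊤∣≡n _))) T T-disjoint (λ _ _ → ∈⊤) ∣T∣≡q∸s
                 r r-maximal (λ i m → Equivalence.from (entry i _) (proj₂ (∈─⁻ ⊤ (T i) m))) missed)
    where
    missed : ∀ i → ∃[ y ] (y ∈ T i × c y ∉ r i)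
    missed i with q∸s-sized⇒Nonempty (T i) s<q (∣T∣≡q∸s i)
    ... | y , y∈T = y , y∈T , (λ cy∈r → Equivalence.to (entry i y) cy∈r y∈T)

  jconfig⇒¬vi : JConfig G p q → ¬ cond-vi
  jconfig⇒¬vi J vi = vi (JConfig.s J) (JConfig.s<q J) (jconfig⇒containsJ J)

-- Oculars are not (p,q)-clique-Helly

module OcularNotHelly {k p q s : ℕ} (H : Graph k) (p≥1 : 1 ≤ p) (s<q : s < q) (U W : Subset k)
  (T : Fin (suc p) → Subset k) (U-W-disjoint : Empty (U ∩ W)) (U∪W≡⊤ : U ∪ W ≡ ⊤) (∣U∣≡Jsize : ∣ U ∣ ≡ Jsize p q s)
  (T-disjoint : PairwiseDisjoint T) (T⊆U : ∀ i → T i ⊆ U) (∣T∣≡q∸s : ∀ i → ∣ T i ∣ ≡ q ∸ s) where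

  U⊎W : ∀ x → x ∈ U ⊎ x ∈ W
  U⊎W x = x∈p∪q⁻ U W (subst (x ∈_) (sym U∪W≡⊤) ∈⊤)

  ∉U∩W : ∀ {x} → x ∈ U → x ∉ W
  ∉U∩W x∈U x∈W = U-W-disjoint (_ , x∈p∩q⁺ (x∈U , x∈W))

  y : Fin (suc p) → Fin k
  y i = proj₁ (q∸s-sized⇒Nonempty (T i) s<q (∣T∣≡q∸s i))

  y∈T : ∀ i → y i ∈ T i
  y∈T i = proj₂ (q∸s-sized⇒Nonempty (T i) s<q (∣T∣≡q∸s i))

  T⊆U─T : ∀ i j → j ≢ i → T j ⊆ U ─ T i
  T⊆U─T i j j≢i m = x∈p∧x∉q⇒x∈p─q (T⊆U j m) (λ m′ → T-disjoint j i j≢i (_ , x∈p∩q⁺ (m , m′)))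

  -- Cliques whose maximal extensions form a critical family with core inside
  -- U ─ ⋃ T, a set of only s < q vertices.
  record Sides : Set where
    field
      side             : Fin (suc p) → Subset k
      U─T⊆side         : ∀ i → U ─ T i ⊆ side i
      side-clique      : ∀ i → IsClique H (side i)
      side-misses-T    : ∀ i K → MaximalClique H K → side i ⊆ K → ∀ x → x ∈ T i → x ∉ K
      no-common-W      : ∀ (K : Fin (suc p) → Subset k) → (∀ i → IsClique H (K i)) → (∀ i → side i ⊆ K i) →
                         ∀ x → x ∈ W → ¬ (∀ i → x ∈ K i)

  sides⇒¬helly : Sides → ¬ CliqueHelly p q H
  sides⇒¬helly sides helly =
    <⇒≱ s<q (≤-trans (helly family family≢[] family⊆Fam intersecting) (≤-trans (p⊆q⇒∣p∣≤∣q∣ core⊆) (≤-reflexive ∣U─⋃T∣≡s)))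
    where
    open Sides sides
    extended : ∀ i → Σ[ K ∈ Subset k ] (MaximalClique H K × side i ⊆ K)
    extended i = extendToMaximal H (side i) (side-clique i)
    K : Fin (suc p) → Subset k
    K i = proj₁ (extended i)
    K-maximal : ∀ i → MaximalClique H (K i)
    K-maximal i = proj₁ (proj₂ (extended i))
    T∉K : ∀ i {x} → x ∈ T i → x ∉ K i
    T∉K i {x} x∈T = side-misses-T i (K i) (K-maximal i) (proj₂ (proj₂ (extended i))) x x∈T
    P : CriticalCliques H p q
    P = covering⇒critical id id s<q U (≤-reflexive (sym ∣U∣≡Jsize)) T T-disjoint T⊆U ∣T∣≡q∸s K K-maximal
          (λ i m → proj₂ (proj₂ (extended i)) (U─T⊆side i m)) (λ i → y i , y∈T i , T∉K i (y∈T i))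
    open Critical P using (family; family≢[]; family⊆Fam; intersecting; ∈core⁻)
    core⊆ : core family ⊆ U ─ ⋃ᶠ T
    core⊆ {x} mx with ∈core⁻ mx | U⊎W x
    ... | x∈K | inj₂ x∈W = absurd (no-common-W K (proj₁ ∘ K-maximal) (proj₂ ∘ proj₂ ∘ extended) x x∈W x∈K)
    ... | x∈K | inj₁ x∈U = x∈p∧x∉q⇒x∈p─q x∈U (λ m⋃ → let (i , x∈T) = ⋃ᶠ⁻ T m⋃ in T∉K i x∈T (x∈K i))
    ∣U─⋃T∣≡s : ∣ U ─ ⋃ᶠ T ∣ ≡ s
    ∣U─⋃T∣≡s = +-cancelʳ-≡ _ _ _ (begin
      ∣ U ─ ⋃ᶠ T ∣ + ∣ ⋃ᶠ T ∣     ≡⟨ ∣p∣≡∣p─q∣+∣q∣ U (⋃ᶠ T) (λ m → let (i , x∈T) = ⋃ᶠ⁻ T m in T⊆U i x∈T) ⟨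
      ∣ U ∣                        ≡⟨ ∣U∣≡Jsize ⟩
      suc p * (q ∸ s) + s          ≡⟨ +-comm (suc p * (q ∸ s)) s ⟩
      s + suc p * (q ∸ s)          ≡⟨ cong (s +_) (∣⋃ᶠ∣≡ T (q ∸ s) T-disjoint ∣T∣≡q∸s) ⟨
      s + ∣ ⋃ᶠ T ∣                 ∎)
      where open ≡-Reasoning

  α₁-sides : W ≡ ⊥ → (∀ i → IsClique H (U ─ T i) × (∀ v → v ∈ T i → ¬ IsClique H ((U ─ T i) ∪ ⁅ v ⁆))) → Sides
  α₁-sides W≡⊥ h = record
    { side = λ i → U ─ T i ; U─T⊆side = λ i → id ; side-clique = proj₁ ∘ h
    ; side-misses-T = λ i K K-maximal ⊆K x x∈T x∈K → proj₂ (h i) x x∈T (clique-⊆ H (∪-⊆ ⊆K (⁅⁆-⊆ x∈K)) (proj₁ K-maximal))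
    ; no-common-W = λ K _ _ x x∈W _ → ∉⊥ (subst (x ∈_) W≡⊥ x∈W) }

  α₂-sides : (w : Fin (suc p) → Fin k) → (∀ v → v ∈ W ⇔ (∃[ i ] w i ≡ v)) → IsClique H U →
             (∀ i → Complete H (w i) (U ─ T i) × Anticomplete H (w i) (T i)) → Sides
  α₂-sides w W≡w U-clique w-sees = record
    { side = side ; U─T⊆side = λ i m → x∈p∪q⁺ (inj₁ m)
    ; side-clique = λ i → clique-∪⁅⁆ H (clique-⊆ H (p─q⊆p U (T i)) U-clique) (proj₁ (w-sees i))
    ; side-misses-T = misses ; no-common-W = noCommon }
    where
    side : Fin (suc p) → Subset k
    side i = (U ─ T i) ∪ ⁅ w i ⁆
    w∈W : ∀ i → w i ∈ W
    w∈W i = Equivalence.from (W≡w (w i)) (i , refl)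
    w∈side : ∀ i → w i ∈ side i
    w∈side i = x∈p∪q⁺ (inj₂ (x∈⁅x⁆ (w i)))
    misses : ∀ i K → MaximalClique H K → side i ⊆ K → ∀ x → x ∈ T i → x ∉ K
    misses i K K-maximal ⊆K x x∈T x∈K =
      true≢false (trans (sym (proj₁ K-maximal (w i) x (⊆K (w∈side i)) x∈K (x≢w ∘ sym))) (proj₂ (w-sees i) x x∈T x≢w))
      where
      x≢w : x ≢ w i
      x≢w e = ∉U∩W (T⊆U i x∈T) (subst (_∈ W) (sym e) (w∈W i))
    -- w j is anticomplete to T j, which lies in U ─ T i for any other index i.
    noCommon : ∀ (K : Fin (suc p) → Subset k) → (∀ i → IsClique H (K i)) → (∀ i → side i ⊆ K i) →
               ∀ x → x ∈ W → ¬ (∀ i → x ∈ K i)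
    noCommon K K-clique ⊆K x x∈W x∈K with Equivalence.to (W≡w x) x∈W
    ... | j , refl = true≢false (trans (sym (K-clique i (w j) (y j) (x∈K i) (⊆K i (x∈p∪q⁺ (inj₁ (T⊆U─T i j j≢i (y∈T j))))) w≢y))
                                       (proj₂ (w-sees j) (y j) (y∈T j) (w≢y ∘ sym)))
      where
      i : Fin (suc p)
      i = punchIn j (fromℕ< p≥1)
      j≢i : j ≢ i
      j≢i e = punchInᵢ≢i j (fromℕ< p≥1) (sym e)
      w≢y : w j ≢ y j
      w≢y e = ∉U∩W (T⊆U j (y∈T j)) (subst (_∈ W) e x∈W)

ocular⇒¬cliqueHelly : ∀ {k p q s} (H : Graph k) → 1 ≤ p → s < q → Ocular p q s H → ¬ CliqueHelly p q H
ocular⇒¬cliqueHelly H p≥1 s<q (U , W , T , U-W-disjoint , U∪W≡⊤ , ∣U∣≡Jsize , T-disjoint , T⊆U , ∣T∣≡q∸s , shape) =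
  sides⇒¬helly (sides shape)
  where
  open OcularNotHelly H p≥1 s<q U W T U-W-disjoint U∪W≡⊤ ∣U∣≡Jsize T-disjoint T⊆U ∣T∣≡q∸s
  sides : _ → Sides
  sides (inj₁ (_ , W≡⊥ , h)) = α₁-sides W≡⊥ h
  sides (inj₂ (_ , w , _ , W≡w , U-clique , w-sees)) = α₂-sides w W≡w U-clique w-sees

-- From a critical family to an induced ocular: p ≥ 2

module Reduction (p q : ℕ) {n : ℕ} (G : Graph n) (p≥2 : 2 ≤ p) where

  record State : Set where
    field
      s            : ℕ
      s<q          : s < q
      S            : Subset n
      T            : Fin (suc p) → Subset n
      ∣S∣≡s        : ∣ S ∣ ≡ s
      ∣T∣≡q∸s      : ∀ i → ∣ T i ∣ ≡ q ∸ s
      S-T-disjoint : ∀ i → Empty (S ∩ T i)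
      T-disjoint   : PairwiseDisjoint T
      U-clique     : IsClique G (S ∪ ⋃ᶠ T)
      spoiled      : Spoiled G (S ∪ ⋃ᶠ T) T

    open Blocks S T S-T-disjoint T-disjoint public

  -- w plays the role of the vertex w i of an (α₂) ocular.
  Eye : State → Fin (suc p) → Fin n → Set
  Eye R i w = Complete G w (U ─ T i) × Anticomplete G w (T i) × w ∉ T i
    where open State R

  Eye? : ∀ R i w → Dec (Eye R i w)
  Eye? R i w = complete? G w _ ×-dec anticomplete? G w _ ×-dec ¬? (w ∈? State.T R i)

  EyedState : Set
  EyedState = Σ[ R ∈ State ] Σ[ w ∈ (Fin (suc p) → Fin n) ] (∀ i → Eye R i (w i))

  -- If T i has no eye, a spoiler u of some v ∈ T i is not an eye either, so its
  -- closed neighbourhood R meets T i.  Moving T i ∩ R into S (and shrinking the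
  -- other T j to the same size) gives a state with larger s: u still spoils the
  -- vertices left in T i.
  module Step (R : State) (i : Fin (suc p)) (eyeless : ¬ (∃[ w ] Eye R i w)) where
    open State R

    t : ℕ
    t = q ∸ s
    v : Fin n
    v = proj₁ (q∸s-sized⇒Nonempty (T i) s<q (∣T∣≡q∸s i))
    v∈T : v ∈ T i
    v∈T = proj₂ (q∸s-sized⇒Nonempty (T i) s<q (∣T∣≡q∸s i))
    u : Fin n
    u = proj₁ (spoiled i v v∈T)
    u≢v : u ≢ v
    u≢v = proj₁ (proj₂ (spoiled i v v∈T))
    u-complete : Complete G u (U ─ T i)
    u-complete = proj₁ (proj₂ (proj₂ (spoiled i v v∈T)))

    moved : Subset n
    moved = T i ∩ closedNbhd G u
    moved⊆T : moved ⊆ T i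
    moved⊆T m = proj₁ (x∈p∩q⁻ (T i) _ m)
    moved⊆N : moved ⊆ closedNbhd G u
    moved⊆N m = proj₂ (x∈p∩q⁻ (T i) _ m)

    v∉N : v ∉ closedNbhd G u
    v∉N m with ∈closedNbhd⁻ G m
    ... | inj₁ v≡u = u≢v (sym v≡u)
    ... | inj₂ a = true≢false (trans (sym a) (trans (gsym G u v) (proj₂ (proj₂ (proj₂ (spoiled i v v∈T))))))

    moved-nonempty : Nonempty moved
    moved-nonempty with nonempty? moved
    ... | yes ne = ne
    ... | no empty = absurd (eyeless (u , u-complete , anticomplete , u∉T))
      where
      anticomplete : Anticomplete G u (T i)
      anticomplete x x∈T _ with adj G u x in eq
      ... | false = refl
      ... | true = absurd (empty (x , x∈p∩q⁺ (x∈T , ∈closedNbhd⁺ G eq)))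
      u∉T : u ∉ T i
      u∉T u∈T = empty (u , x∈p∩q⁺ (u∈T , closedNbhd∋ G u))

    r : ℕ
    r = ∣ moved ∣
    ∣T─moved∣+r≡t : ∣ T i ─ moved ∣ + r ≡ t
    ∣T─moved∣+r≡t = trans (sym (∣p∣≡∣p─q∣+∣q∣ (T i) moved moved⊆T)) (∣T∣≡q∸s i)
    ∣T─moved∣≡t∸r : ∣ T i ─ moved ∣ ≡ t ∸ r
    ∣T─moved∣≡t∸r = trans (sym (m+n∸n≡m _ r)) (cong (_∸ r) ∣T─moved∣+r≡t)

    chosenT : ∀ j → Dec (j ≡ i) → Σ[ Y ∈ Subset n ] (Y ⊆ T j × ∣ Y ∣ ≡ t ∸ r)
    chosenT j (yes refl) = T i ─ moved , p─q⊆p (T i) moved , ∣T─moved∣≡t∸r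
    chosenT j (no _) = subsetOfSize (T j) (t ∸ r) (≤-trans (m∸n≤m t r) (≤-reflexive (sym (∣T∣≡q∸s j))))
    T′ : Fin (suc p) → Subset n
    T′ j = proj₁ (chosenT j (j ≟ i))
    T′⊆T : ∀ j → T′ j ⊆ T j
    T′⊆T j = proj₁ (proj₂ (chosenT j (j ≟ i)))
    T′i≡ : T′ i ≡ T i ─ moved
    T′i≡ with i ≟ i
    ... | yes refl = refl
    ... | no i≢i = absurd (i≢i refl)
    ≡i⊎≢i : ∀ k → k ≡ i ⊎ k ≢ i
    ≡i⊎≢i k with k ≟ i
    ... | yes k≡i = inj₁ k≡i
    ... | no k≢i = inj₂ k≢i
    S′ : Subset n
    S′ = S ∪ moved
    s′ : ℕ
    s′ = s + r
    q∸s′≡t∸r : q ∸ s′ ≡ t ∸ r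
    q∸s′≡t∸r = sym (∸-+-assoc q s r)

    S′-T′-disjoint : ∀ j → Empty (S′ ∩ T′ j)
    S′-T′-disjoint j (x , m) with x∈p∪q⁻ S moved (proj₁ (x∈p∩q⁻ S′ _ m)) | ≡i⊎≢i j
    ... | inj₁ x∈S | _ = S-T-disjoint j (x , x∈p∩q⁺ (x∈S , T′⊆T j (proj₂ (x∈p∩q⁻ S′ _ m))))
    ... | inj₂ x∈moved | inj₁ refl = proj₂ (∈─⁻ (T i) moved (subst (x ∈_) T′i≡ (proj₂ (x∈p∩q⁻ S′ _ m)))) x∈moved
    ... | inj₂ x∈moved | inj₂ j≢i = T-disjoint i j (j≢i ∘ sym) (x , x∈p∩q⁺ (moved⊆T x∈moved , T′⊆T j (proj₂ (x∈p∩q⁻ S′ _ m))))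

    U′ : Subset n
    U′ = S′ ∪ ⋃ᶠ T′

    U′⁻ : ∀ {x} → x ∈ U′ → x ∈ S ⊎ x ∈ moved ⊎ ∃[ j ] x ∈ T′ j
    U′⁻ m with x∈p∪q⁻ S′ (⋃ᶠ T′) m
    ... | inj₂ m⋃ = inj₂ (inj₂ (⋃ᶠ⁻ T′ m⋃))
    ... | inj₁ mS′ with x∈p∪q⁻ S moved mS′
    ...   | inj₁ x∈S = inj₁ x∈S
    ...   | inj₂ x∈moved = inj₂ (inj₁ x∈moved)

    U′⊆U : U′ ⊆ U
    U′⊆U m with U′⁻ m
    ... | inj₁ x∈S = S⊆U x∈S
    ... | inj₂ (inj₁ x∈moved) = T⊆U i (moved⊆T x∈moved)
    ... | inj₂ (inj₂ (j , x∈T′)) = T⊆U j (T′⊆T j x∈T′)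

    U′─T′⊆ : ∀ k {x} → x ∈ U′ ─ T′ k → x ∈ U ─ T k ⊎ (k ≡ i × x ∈ moved)
    U′─T′⊆ k m with ∈─⁻ U′ (T′ k) m
    ... | x∈U′ , x∉T′ with U′⁻ x∈U′
    ...   | inj₁ x∈S = inj₁ (S⊆U─T k x∈S)
    ...   | inj₂ (inj₂ (j , x∈T′j)) = inj₁ (T⊆U─T k j (λ j≡k → x∉T′ (subst (λ l → _ ∈ T′ l) j≡k x∈T′j)) (T′⊆T j x∈T′j))
    ...   | inj₂ (inj₁ x∈moved) with ≡i⊎≢i k
    ...     | inj₁ k≡i = inj₂ (k≡i , x∈moved)
    ...     | inj₂ k≢i = inj₁ (T⊆U─T k i (k≢i ∘ sym) (moved⊆T x∈moved))

    spoiled′ : Spoiled G U′ T′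
    spoiled′ k v′ v′∈T′ with ≡i⊎≢i k
    ... | inj₂ k≢i with spoiled k v′ (T′⊆T k v′∈T′)
    ...   | u′ , u′≢v′ , complete , nonadjacent = u′ , u′≢v′ , complete′ , nonadjacent
      where
      complete′ : Complete G u′ (U′ ─ T′ k)
      complete′ x m x≢u′ with U′─T′⊆ k m
      ... | inj₁ m′ = complete x m′ x≢u′
      ... | inj₂ (k≡i , _) = absurd (k≢i k≡i)
    spoiled′ k v′ v′∈T′ | inj₁ refl = u , u≢v′ , complete′ , nonadjacent
      where
      v′∉N : v′ ∉ closedNbhd G u
      v′∉N v′∈N = let (v′∈T , v′∉moved) = ∈─⁻ (T i) moved (subst (v′ ∈_) T′i≡ v′∈T′) in
                  v′∉moved (x∈p∩q⁺ (v′∈T , v′∈N))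
      u≢v′ : u ≢ v′
      u≢v′ u≡v′ = v′∉N (subst (_∈ closedNbhd G u) u≡v′ (closedNbhd∋ G u))
      complete′ : Complete G u (U′ ─ T′ i)
      complete′ x m x≢u with U′─T′⊆ i m
      ... | inj₁ m′ = u-complete x m′ x≢u
      ... | inj₂ (_ , x∈moved) with ∈closedNbhd⁻ G (moved⊆N x∈moved)
      ...   | inj₁ x≡u = absurd (x≢u x≡u)
      ...   | inj₂ a = a
      nonadjacent : adj G v′ u ≡ false
      nonadjacent with adj G u v′ in eq
      ... | true = absurd (v′∉N (∈closedNbhd⁺ G eq))
      ... | false = trans (gsym G v′ u) eq

    next : State
    next = record
      { s = s′
      ; s<q = m∸n≢0⇒n<m (λ e → <⇒≢ 0<q∸s′ (sym e))
      ; S = S′ ; T = T′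
      ; ∣S∣≡s = trans (∣p∪q∣≡∣p∣+∣q∣ S moved S-moved-disjoint) (cong (_+ r) ∣S∣≡s)
      ; ∣T∣≡q∸s = λ j → trans (proj₂ (proj₂ (chosenT j (j ≟ i)))) (sym q∸s′≡t∸r)
      ; S-T-disjoint = S′-T′-disjoint
      ; T-disjoint = disjoint-⊆ T′⊆T T-disjoint
      ; U-clique = clique-⊆ G U′⊆U U-clique
      ; spoiled = spoiled′ }
      where
      0<q∸s′ : 0 < q ∸ s′
      0<q∸s′ = subst (1 ≤_) (trans ∣T─moved∣≡t∸r (sym q∸s′≡t∸r)) (∈⇒1≤∣p∣ (x∈p∧x∉q⇒x∈p─q v∈T (v∉N ∘ moved⊆N)))
      S-moved-disjoint : Empty (S ∩ moved)
      S-moved-disjoint (x , m) = S-T-disjoint i (x , x∈p∩q⁺ (proj₁ (x∈p∩q⁻ S moved m) , moved⊆T (proj₂ (x∈p∩q⁻ S moved m))))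

    progress : q ∸ s′ < q ∸ s
    progress = subst (_< t) (sym q∸s′≡t∸r)
                 (∸-monoʳ-< (∈⇒1≤∣p∣ (proj₂ moved-nonempty)) (subst (r ≤_) ∣T─moved∣+r≡t (m≤n+m r _)))

  reduce : ∀ fuel (R : State) → q ∸ State.s R ≤ fuel → EyedState
  reduce fuel R bound with any? (λ i → ¬? (any? (Eye? R i)))
  ... | no allEyed = R , (λ i → proj₁ (eye i)) , (λ i → proj₂ (eye i))
    where
    eye : ∀ i → ∃[ w ] Eye R i w
    eye i with any? (Eye? R i)
    ... | yes found = found
    ... | no none = absurd (allEyed (i , none))
  reduce zero R bound | yes _ = absurd (<⇒≱ (m<n⇒0<n∸m (State.s<q R)) bound)
  reduce (suc fuel) R bound | yes (i , eyeless) =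
    reduce fuel (Step.next R i eyeless) (≤-pred (≤-trans (Step.progress R i eyeless) bound))

  jconfig⇒state : JConfig G p q → State
  jconfig⇒state J = record
    { s = s ; s<q = s<q ; S = S ; T = T ; ∣S∣≡s = ∣S∣≡s ; ∣T∣≡q∸s = ∣T∣≡q∸s
    ; S-T-disjoint = S-T-disjoint ; T-disjoint = T-disjoint
    ; U-clique = clique-from-sides G p≥2 (λ i → clique-⊆ G (U─T⊆K i) (proj₁ (K-maximal i)))
    ; spoiled = spoiled }
    where open JConfig J

  jconfig⇒eyed : JConfig G p q → EyedState
  jconfig⇒eyed J = reduce q (jconfig⇒state J) (m∸n≤m q (JConfig.s J))

module Eyed (p q : ℕ) {n : ℕ} (G : Graph n) (p≥2 : 2 ≤ p) (eyed : Reduction.EyedState p q G p≥2) where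
  open Reduction p q G p≥2

  R : State
  R = proj₁ eyed

  w : Fin (suc p) → Fin n
  w = proj₁ (proj₂ eyed)

  eye : ∀ i → Eye R i (w i)
  eye = proj₂ (proj₂ eyed)

  open State R public

  y : Fin (suc p) → Fin n
  y i = proj₁ (q∸s-sized⇒Nonempty (T i) s<q (∣T∣≡q∸s i))

  y∈T : ∀ i → y i ∈ T i
  y∈T i = proj₂ (q∸s-sized⇒Nonempty (T i) s<q (∣T∣≡q∸s i))

  -- w i is anticomplete to T i, while U is a clique.
  w∉U : ∀ i → w i ∉ U
  w∉U i m = true≢false (trans (sym (U-clique (w i) (y i) m (T⊆U i (y∈T i)) w≢y)) (proj₁ (proj₂ (eye i)) (y i) (y∈T i) (w≢y ∘ sym)))
    where
    w≢y : w i ≢ y i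
    w≢y e = proj₂ (proj₂ (eye i)) (subst (_∈ T i) (sym e) (y∈T i))

  w-y-nonadjacent : ∀ i → adj G (w i) (y i) ≡ false
  w-y-nonadjacent i = proj₁ (proj₂ (eye i)) (y i) (y∈T i) (λ e → w∉U i (subst (_∈ U) e (T⊆U i (y∈T i))))

  -- w i is complete to T j ⊆ U ─ T i and w j is anticomplete to it.
  w-injective : ∀ {i j} → w i ≡ w j → i ≡ j
  w-injective {i} {j} e with i ≟ j
  ... | yes i≡j = i≡j
  ... | no i≢j = absurd (true≢false (trans (sym (proj₁ (eye i) (y j) (T⊆U─T i j (i≢j ∘ sym) (y∈T j)) y≢w))
                         (subst (λ z → adj G z (y j) ≡ false) (sym e) (w-y-nonadjacent j))))
    where
    y≢w : y j ≢ w i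
    y≢w e′ = w∉U i (subst (_∈ U) e′ (T⊆U j (y∈T j)))

  -- U together with the eyes induces an (α₂) ocular.
  ocular : Σ[ X ∈ Subset n ] Σ[ s ∈ ℕ ] (s < q × Ocular p q s (induced G X))
  ocular = X , s , s<q ,
    restrict X U , restrict X W , TX , UX-WX-disjoint , UX∪WX≡⊤ ,
    trans (∣restrict∣≡∣p∣ X U U⊆X) (∣U∣≡ ∣S∣≡s ∣T∣≡q∸s) , restrict-disjoint X T-disjoint ,
    (λ i m → restrict∈⁺ X U (T⊆U i (restrict∈⁻ X (T i) m))) ,
    (λ i → trans (∣restrict∣≡∣p∣ X (T i) (U⊆X ∘ T⊆U i)) (∣T∣≡q∸s i)) ,
    inj₂ (p≥2 , wX , wX-injective , WX≡wX , U-cliqueX , λ i → completeX i , anticompleteX i)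
    where
    W : Subset n
    W = ⋃ᶠ (⁅_⁆ ∘ w)
    W⁻ : ∀ {x} → x ∈ W → ∃[ i ] w i ≡ x
    W⁻ m with ⋃ᶠ⁻ (⁅_⁆ ∘ w) m
    ... | i , mi = i , sym (x∈⁅y⁆⇒x≡y (w i) mi)
    w∈W : ∀ i → w i ∈ W
    w∈W i = ⋃ᶠ⁺ (⁅_⁆ ∘ w) i (x∈⁅x⁆ (w i))
    X : Subset n
    X = U ∪ W
    U⊆X : U ⊆ X
    U⊆X m = x∈p∪q⁺ (inj₁ m)
    TX : Fin (suc p) → Subset ∣ X ∣
    TX i = restrict X (T i)
    wX : Fin (suc p) → Fin ∣ X ∣
    wX i = proj₁ (enum-surjective X (x∈p∪q⁺ (inj₂ (w∈W i))))
    enum-wX : ∀ i → enum X (wX i) ≡ w i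
    enum-wX i = proj₂ (enum-surjective X (x∈p∪q⁺ (inj₂ (w∈W i))))
    UX-WX-disjoint : Empty (restrict X U ∩ restrict X W)
    UX-WX-disjoint (x , m) with W⁻ (restrict∈⁻ X W (proj₂ (x∈p∩q⁻ (restrict X U) _ m)))
    ... | i , e = w∉U i (subst (_∈ U) (sym e) (restrict∈⁻ X U (proj₁ (x∈p∩q⁻ (restrict X U) _ m))))
    UX∪WX≡⊤ : restrict X U ∪ restrict X W ≡ ⊤
    UX∪WX≡⊤ = ⊆-antisym ⊆⊤ λ {x} _ → case x∈p∪q⁻ U W (enum∈ X x) of λ where
      (inj₁ m) → x∈p∪q⁺ (inj₁ (restrict∈⁺ X U m))
      (inj₂ m) → x∈p∪q⁺ (inj₂ (restrict∈⁺ X W m))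
    wX-injective : Injective _≡_ _≡_ wX
    wX-injective e = w-injective (trans (sym (enum-wX _)) (trans (cong (enum X) e) (enum-wX _)))
    WX≡wX : ∀ v → v ∈ restrict X W ⇔ (∃[ i ] wX i ≡ v)
    WX≡wX v = mk⇔
      (λ m → let (i , e) = W⁻ (restrict∈⁻ X W m) in i , enum-injective X (trans (enum-wX i) e))
      (λ { (i , refl) → restrict∈⁺ X W (subst (_∈ W) (sym (enum-wX i)) (w∈W i)) })
    U-cliqueX : IsClique (induced G X) (restrict X U)
    U-cliqueX a b ma mb a≢b = U-clique _ _ (restrict∈⁻ X U ma) (restrict∈⁻ X U mb) (a≢b ∘ enum-injective X)
    completeX : ∀ i → Complete (induced G X) (wX i) (restrict X U ─ TX i)
    completeX i x m x≢w = subst (λ z → adj G z (enum X x) ≡ true) (sym (enum-wX i))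
      (proj₁ (eye i) (enum X x) (x∈p∧x∉q⇒x∈p─q x∈U (x∉TX ∘ restrict∈⁺ X (T i)))
        (λ e → w∉U i (subst (_∈ U) e x∈U)))
      where
      x∈U : enum X x ∈ U
      x∈U = restrict∈⁻ X U (proj₁ (∈─⁻ (restrict X U) (TX i) m))
      x∉TX : x ∉ TX i
      x∉TX = proj₂ (∈─⁻ (restrict X U) (TX i) m)
    anticompleteX : ∀ i → Anticomplete (induced G X) (wX i) (TX i)
    anticompleteX i x m x≢w = subst (λ z → adj G z (enum X x) ≡ false) (sym (enum-wX i))
      (proj₁ (proj₂ (eye i)) (enum X x) (restrict∈⁻ X (T i) m) (λ e → w∉U i (subst (_∈ U) e (T⊆U i (restrict∈⁻ X (T i) m)))))

-- From a critical family to an induced ocular: p = 1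

module PairReduction (q : ℕ) {n : ℕ} (G : Graph n) where

  record PairState : Set where
    field
      s              : ℕ
      s<q            : s < q
      S T₀ T₁        : Subset n
      ∣S∣≡s          : ∣ S ∣ ≡ s
      ∣T₀∣≡q∸s       : ∣ T₀ ∣ ≡ q ∸ s
      ∣T₁∣≡q∸s       : ∣ T₁ ∣ ≡ q ∸ s
      S-T₀-disjoint  : Empty (S ∩ T₀)
      S-T₁-disjoint  : Empty (S ∩ T₁)
      T₀-T₁-disjoint : Empty (T₀ ∩ T₁)
      S∪T₁-clique    : IsClique G (S ∪ T₁)
      S∪T₀-clique    : IsClique G (S ∪ T₀)
      x₀ x₁          : Fin n
      x₀∈T₀          : x₀ ∈ T₀
      x₁∈T₁          : x₁ ∈ T₁
      x₀x₁-nonadjacent : adj G x₀ x₁ ≡ false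

    T₀∩T₁ : ∀ {x} → x ∈ T₀ → x ∉ T₁
    T₀∩T₁ x∈T₀ x∈T₁ = T₀-T₁-disjoint (_ , x∈p∩q⁺ (x∈T₀ , x∈T₁))

  swap : PairState → PairState
  swap V = record
    { s = s ; s<q = s<q ; S = S ; T₀ = T₁ ; T₁ = T₀ ; ∣S∣≡s = ∣S∣≡s ; ∣T₀∣≡q∸s = ∣T₁∣≡q∸s ; ∣T₁∣≡q∸s = ∣T₀∣≡q∸s
    ; S-T₀-disjoint = S-T₁-disjoint ; S-T₁-disjoint = S-T₀-disjoint
    ; T₀-T₁-disjoint = λ (x , m) → T₀∩T₁ (proj₂ (x∈p∩q⁻ T₁ T₀ m)) (proj₁ (x∈p∩q⁻ T₁ T₀ m))
    ; S∪T₁-clique = S∪T₀-clique ; S∪T₀-clique = S∪T₁-clique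
    ; x₀ = x₁ ; x₁ = x₀ ; x₀∈T₀ = x₁∈T₁ ; x₁∈T₁ = x₀∈T₀ ; x₀x₁-nonadjacent = trans (gsym G x₁ x₀) x₀x₁-nonadjacent }
    where open PairState V

  CompleteToT₁ : PairState → Fin n → Set
  CompleteToT₁ V v = v ∈ PairState.T₀ V × (∀ y → y ∈ PairState.T₁ V → adj G v y ≡ true)

  CompleteToT₁? : ∀ V v → Dec (CompleteToT₁ V v)
  CompleteToT₁? V v = (v ∈? PairState.T₀ V) ×-dec all? (λ y → (y ∈? PairState.T₁ V) →-dec (adj G v y ≟b true))

  -- No vertex of one side is complete to the other: the (α₁) ocular condition.
  Stuck : PairState → Set
  Stuck V = (∀ v → v ∈ T₀ → ∃[ y ] (y ∈ T₁ × adj G v y ≡ false))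
          × (∀ v → v ∈ T₁ → ∃[ y ] (y ∈ T₀ × adj G v y ≡ false))
    where open PairState V

  -- Move v into S, and drop a vertex other than x₁ from T₁.
  module Step (V : PairState) (v : Fin n) (complete : CompleteToT₁ V v) where
    open PairState V

    v∈T₀ : v ∈ T₀
    v∈T₀ = proj₁ complete
    t : ℕ
    t = q ∸ s
    v≢x₀ : v ≢ x₀
    v≢x₀ e = true≢false (trans (sym (proj₂ complete x₁ x₁∈T₁)) (subst (λ z → adj G z x₁ ≡ false) (sym e) x₀x₁-nonadjacent))
    T₀′ : Subset n
    T₀′ = T₀ - v
    T₀′⊆T₀ : T₀′ ⊆ T₀
    T₀′⊆T₀ = p─q⊆p T₀ ⁅ v ⁆
    x₀∈T₀′ : x₀ ∈ T₀′
    x₀∈T₀′ = x∈p∧x≢y⇒x∈p-y x₀∈T₀ (v≢x₀ ∘ sym)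
    ∣T₀′∣≡t∸1 : ∣ T₀′ ∣ ≡ t ∸ 1
    ∣T₀′∣≡t∸1 = trans (sym (m+n∸n≡m _ 1))
      (cong (_∸ 1) (trans (sym (trans (∣p∣≡∣p─q∣+∣q∣ T₀ ⁅ v ⁆ (⁅⁆-⊆ v∈T₀)) (cong (∣ T₀′ ∣ +_) (∣⁅x⁆∣≡1 v)))) ∣T₀∣≡q∸s))
    1≤t∸1 : 1 ≤ t ∸ 1
    1≤t∸1 = subst (1 ≤_) ∣T₀′∣≡t∸1 (∈⇒1≤∣p∣ x₀∈T₀′)
    chosenT₁ : Σ[ Y ∈ Subset n ] (Y ⊆ T₁ × x₁ ∈ Y × ∣ Y ∣ ≡ t ∸ 1)
    chosenT₁ = subsetOfSize∋ T₁ x₁∈T₁ (t ∸ 1) 1≤t∸1 (≤-trans (m∸n≤m t 1) (≤-reflexive (sym ∣T₁∣≡q∸s)))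
    T₁′ : Subset n
    T₁′ = proj₁ chosenT₁
    T₁′⊆T₁ : T₁′ ⊆ T₁
    T₁′⊆T₁ = proj₁ (proj₂ chosenT₁)
    q∸[s+1]≡t∸1 : q ∸ (s + 1) ≡ t ∸ 1
    q∸[s+1]≡t∸1 = sym (∸-+-assoc q s 1)
    v-adjacent : ∀ {a} → a ∈ S ∪ T₁ → a ≢ v → adj G v a ≡ true
    v-adjacent {a} m a≢v with x∈p∪q⁻ S T₁ m
    ... | inj₁ a∈S = S∪T₀-clique v a (x∈p∪q⁺ (inj₂ v∈T₀)) (x∈p∪q⁺ (inj₁ a∈S)) (a≢v ∘ sym)
    ... | inj₂ a∈T₁ = proj₂ complete a a∈T₁
    S′∪T₁′⊆ : (S ∪ ⁅ v ⁆) ∪ T₁′ ⊆ (S ∪ T₁) ∪ ⁅ v ⁆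
    S′∪T₁′⊆ = ∪-⊆ (∪-⊆ (λ m → x∈p∪q⁺ (inj₁ (x∈p∪q⁺ (inj₁ m)))) (λ m → x∈p∪q⁺ (inj₂ m)))
                  (λ m → x∈p∪q⁺ (inj₁ (x∈p∪q⁺ (inj₂ (T₁′⊆T₁ m)))))
    S′∪T₀′⊆ : (S ∪ ⁅ v ⁆) ∪ T₀′ ⊆ S ∪ T₀
    S′∪T₀′⊆ = ∪-⊆ (∪-⊆ (λ m → x∈p∪q⁺ (inj₁ m)) (λ m → x∈p∪q⁺ (inj₂ (⁅⁆-⊆ v∈T₀ m)))) (λ m → x∈p∪q⁺ (inj₂ (T₀′⊆T₀ m)))
    S∌ : ∀ {x} → x ∈ S → x ∈ T₀ ⊎ x ∈ T₁ → Void
    S∌ x∈S (inj₁ x∈T₀) = S-T₀-disjoint (_ , x∈p∩q⁺ (x∈S , x∈T₀))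
    S∌ x∈S (inj₂ x∈T₁) = S-T₁-disjoint (_ , x∈p∩q⁺ (x∈S , x∈T₁))

    next : PairState
    next = record
      { s = s + 1
      ; s<q = m∸n≢0⇒n<m (λ e → <⇒≢ (subst (1 ≤_) (sym q∸[s+1]≡t∸1) 1≤t∸1) (sym e))
      ; S = S ∪ ⁅ v ⁆ ; T₀ = T₀′ ; T₁ = T₁′
      ; ∣S∣≡s = trans (∣p∪⁅x⁆∣≡1+∣p∣ S (λ v∈S → S∌ v∈S (inj₁ v∈T₀))) (trans (cong suc ∣S∣≡s) (+-comm 1 s))
      ; ∣T₀∣≡q∸s = trans ∣T₀′∣≡t∸1 (sym q∸[s+1]≡t∸1)
      ; ∣T₁∣≡q∸s = trans (proj₂ (proj₂ (proj₂ chosenT₁))) (sym q∸[s+1]≡t∸1)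
      ; S-T₀-disjoint = λ (x , m) → S′∌ (proj₁ (x∈p∩q⁻ _ T₀′ m)) (inj₁ (proj₂ (x∈p∩q⁻ _ T₀′ m)))
      ; S-T₁-disjoint = λ (x , m) → S′∌ (proj₁ (x∈p∩q⁻ _ T₁′ m)) (inj₂ (proj₂ (x∈p∩q⁻ _ T₁′ m)))
      ; T₀-T₁-disjoint = λ (x , m) → T₀∩T₁ (T₀′⊆T₀ (proj₁ (x∈p∩q⁻ T₀′ T₁′ m))) (T₁′⊆T₁ (proj₂ (x∈p∩q⁻ T₀′ T₁′ m)))
      ; S∪T₁-clique = clique-⊆ G S′∪T₁′⊆ (clique-∪⁅⁆ G S∪T₁-clique (λ a m a≢v → v-adjacent m a≢v))
      ; S∪T₀-clique = clique-⊆ G S′∪T₀′⊆ S∪T₀-clique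
      ; x₀ = x₀ ; x₁ = x₁ ; x₀∈T₀ = x₀∈T₀′ ; x₁∈T₁ = proj₁ (proj₂ (proj₂ chosenT₁))
      ; x₀x₁-nonadjacent = x₀x₁-nonadjacent }
      where
      S′∌ : ∀ {x} → x ∈ S ∪ ⁅ v ⁆ → x ∈ T₀′ ⊎ x ∈ T₁′ → Void
      S′∌ m x∈T′ with ∈∪⁅⁆⁻ S m | x∈T′
      ... | inj₁ x∈S | inj₁ x∈T₀′ = S∌ x∈S (inj₁ (T₀′⊆T₀ x∈T₀′))
      ... | inj₁ x∈S | inj₂ x∈T₁′ = S∌ x∈S (inj₂ (T₁′⊆T₁ x∈T₁′))
      ... | inj₂ refl | inj₁ v∈T₀′ = proj₂ (∈─⁻ T₀ ⁅ v ⁆ v∈T₀′) (x∈⁅x⁆ v)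
      ... | inj₂ refl | inj₂ v∈T₁′ = T₀∩T₁ v∈T₀ (T₁′⊆T₁ v∈T₁′)

    progress : q ∸ (s + 1) < q ∸ s
    progress = subst (_< t) (sym q∸[s+1]≡t∸1) (∸-monoʳ-< (s≤s z≤n) (subst (1 ≤_) ∣T₀∣≡q∸s (∈⇒1≤∣p∣ x₀∈T₀)))

  nonNeighbourIn : ∀ (A B : Subset n) v → v ∈ A → ¬ (v ∈ A × (∀ y → y ∈ B → adj G v y ≡ true)) →
                   ∃[ y ] (y ∈ B × adj G v y ≡ false)
  nonNeighbourIn A B v v∈A ¬complete
    with ¬∀⟶∃¬ n _ (λ y → (y ∈? B) →-dec (adj G v y ≟b true)) (λ h → ¬complete (v∈A , h))
  ... | y , bad with y ∈? B | adj G v y in eq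
  ... | no y∉B | _ = absurd (bad (λ y∈B → absurd (y∉B y∈B)))
  ... | yes _ | true = absurd (bad (λ _ → refl))
  ... | yes y∈B | false = y , y∈B , eq

  reduce : ∀ fuel (V : PairState) → q ∸ PairState.s V ≤ fuel → Σ[ V′ ∈ PairState ] Stuck V′
  reduce fuel V bound with any? (CompleteToT₁? V) | any? (CompleteToT₁? (swap V))
  reduce zero V bound | _ | _ = absurd (<⇒≱ (m<n⇒0<n∸m (PairState.s<q V)) bound)
  reduce (suc fuel) V bound | yes (v , c) | _ = reduce fuel (Step.next V v c) (≤-pred (≤-trans (Step.progress V v c) bound))
  reduce (suc fuel) V bound | no _ | yes (v , c) =
    reduce fuel (Step.next (swap V) v c) (≤-pred (≤-trans (Step.progress (swap V) v c) bound))
  reduce (suc fuel) V bound | no none₀ | no none₁ =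
    V , (λ v m → nonNeighbourIn _ _ v m (λ c → none₀ (v , c))) , (λ v m → nonNeighbourIn _ _ v m (λ c → none₁ (v , c)))

  -- T₁ is replaced by a (q ∸ s)-subset of K 0 ─ K 1 containing a non-neighbour
  -- x₁ of some x₀ ∈ T 0.
  jconfig⇒pairState : JConfig G 1 q → PairState
  jconfig⇒pairState J = record
    { s = s ; s<q = s<q ; S = S ; T₀ = T zero ; T₁ = T₁′ ; ∣S∣≡s = ∣S∣≡s ; ∣T₀∣≡q∸s = ∣T∣≡q∸s zero
    ; ∣T₁∣≡q∸s = proj₂ (proj₂ (proj₂ chosen))
    ; S-T₀-disjoint = S-T-disjoint zero
    ; S-T₁-disjoint = λ (x , m) → ∉K₁ (T₁′⊆ (proj₂ (x∈p∩q⁻ S T₁′ m))) (S⊆K (suc zero) (proj₁ (x∈p∩q⁻ S T₁′ m)))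
    ; T₀-T₁-disjoint = λ (x , m) → ∉K₁ (T₁′⊆ (proj₂ (x∈p∩q⁻ (T zero) T₁′ m))) (T⊆K (suc zero) zero (λ ()) (proj₁ (x∈p∩q⁻ (T zero) T₁′ m)))
    ; S∪T₁-clique = clique-⊆ G (∪-⊆ (S⊆K zero) (λ m → proj₁ (∈─⁻ (K zero) _ (T₁′⊆ m)))) (proj₁ (K-maximal zero))
    ; S∪T₀-clique = clique-⊆ G (∪-⊆ (S⊆K (suc zero)) (T⊆K (suc zero) zero (λ ()))) (proj₁ (K-maximal (suc zero)))
    ; x₀ = x₀ ; x₁ = x₁ ; x₀∈T₀ = x₀∈T₀ ; x₁∈T₁ = proj₁ (proj₂ (proj₂ chosen)) ; x₀x₁-nonadjacent = nonadjacent }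
    where
    open JConfig J
    x₀ : Fin n
    x₀ = proj₁ (q∸s-sized⇒Nonempty (T zero) s<q (∣T∣≡q∸s zero))
    x₀∈T₀ : x₀ ∈ T zero
    x₀∈T₀ = proj₂ (q∸s-sized⇒Nonempty (T zero) s<q (∣T∣≡q∸s zero))
    nonNeighbourOfx₀ : ∃[ u ] (u ∈ K zero × u ≢ x₀ × adj G x₀ u ≡ false)
    nonNeighbourOfx₀ = nonNeighbour G (K-maximal zero) (T∉K zero x₀∈T₀)
    x₁ : Fin n
    x₁ = proj₁ nonNeighbourOfx₀
    nonadjacent : adj G x₀ x₁ ≡ false
    nonadjacent = proj₂ (proj₂ (proj₂ nonNeighbourOfx₀))
    Z : Subset n
    Z = K zero ─ K (suc zero)
    ∉K₁ : ∀ {x} → x ∈ Z → x ∉ K (suc zero)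
    ∉K₁ m = proj₂ (∈─⁻ (K zero) _ m)
    -- x₀ ∈ K 1, so its non-neighbour x₁ is not.
    x₁∈Z : x₁ ∈ Z
    x₁∈Z = x∈p∧x∉q⇒x∈p─q (proj₁ (proj₂ nonNeighbourOfx₀)) λ x₁∈K₁ →
      true≢false (trans (sym (proj₁ (K-maximal (suc zero)) x₀ x₁ (T⊆K (suc zero) zero (λ ()) x₀∈T₀) x₁∈K₁
                                (proj₁ (proj₂ (proj₂ nonNeighbourOfx₀)) ∘ sym))) nonadjacent)
    T₁⊆Z : T (suc zero) ⊆ Z
    T₁⊆Z m = x∈p∧x∉q⇒x∈p─q (T⊆K zero (suc zero) (λ ()) m) (T∉K (suc zero) m)
    chosen : Σ[ Y ∈ Subset n ] (Y ⊆ Z × x₁ ∈ Y × ∣ Y ∣ ≡ q ∸ s)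
    chosen = subsetOfSize∋ Z x₁∈Z (q ∸ s) (m<n⇒0<n∸m s<q) (≤-trans (≤-reflexive (sym (∣T∣≡q∸s (suc zero)))) (p⊆q⇒∣p∣≤∣q∣ T₁⊆Z))
    T₁′ : Subset n
    T₁′ = proj₁ chosen
    T₁′⊆ : T₁′ ⊆ Z
    T₁′⊆ = proj₁ (proj₂ chosen)

  jconfig⇒stuck : JConfig G 1 q → Σ[ V ∈ PairState ] Stuck V
  jconfig⇒stuck J = reduce q V (m∸n≤m q (PairState.s V))
    where
    V : PairState
    V = jconfig⇒pairState J

module _ (q : ℕ) {n : ℕ} (G : Graph n) where
  open PairReduction q G

  -- S ∪ T₀ ∪ T₁ induces an (α₁) ocular.
  stuck⇒ocular : (V : PairState) → Stuck V → Σ[ X ∈ Subset n ] Σ[ s ∈ ℕ ] (s < q × Ocular 1 q s (induced G X))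
  stuck⇒ocular V (stuck₀ , stuck₁) = U , s , s<q ,
    ⊤ , ⊥ , TU , (λ (x , m) → ∉⊥ (proj₂ (x∈p∩q⁻ ⊤ ⊥ m))) , ⊆-antisym ⊆⊤ (λ _ → x∈p∪q⁺ (inj₁ ∈⊤)) ,
    trans (∣⊤∣≡n _) (∣U∣≡ ∣S∣≡s ∣T∣≡q∸s) ,
    restrict-disjoint U T-disjoint ,
    (λ _ _ → ∈⊤) , (λ i → trans (∣restrict∣≡∣p∣ U (T i) (T⊆U i)) (∣T∣≡q∸s i)) ,
    inj₁ (refl , refl , sides)
    where
    open PairState V
    T : Fin 2 → Subset n
    T zero = T₀
    T (suc zero) = T₁
    ∣T∣≡q∸s : ∀ i → ∣ T i ∣ ≡ q ∸ s
    ∣T∣≡q∸s zero = ∣T₀∣≡q∸s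
    ∣T∣≡q∸s (suc zero) = ∣T₁∣≡q∸s
    S-T-disjoint : ∀ i → Empty (S ∩ T i)
    S-T-disjoint zero = S-T₀-disjoint
    S-T-disjoint (suc zero) = S-T₁-disjoint
    T-disjoint : PairwiseDisjoint T
    T-disjoint zero zero 0≢0 = absurd (0≢0 refl)
    T-disjoint zero (suc zero) _ = T₀-T₁-disjoint
    T-disjoint (suc zero) zero _ (x , m) = T₀∩T₁ (proj₂ (x∈p∩q⁻ T₁ T₀ m)) (proj₁ (x∈p∩q⁻ T₁ T₀ m))
    T-disjoint (suc zero) (suc zero) 1≢1 = absurd (1≢1 refl)
    open Blocks S T S-T-disjoint T-disjoint
    TU : Fin 2 → Subset ∣ U ∣
    TU i = restrict U (T i)
    side-clique : ∀ (A B : Subset n) → (∀ {x} → x ∈ U → x ∉ A → x ∈ S ∪ B) → IsClique G (S ∪ B) →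
                  IsClique (induced G U) (⊤ ─ restrict U A)
    side-clique A B ⊆S∪B clique a b ma mb a≢b =
      clique (enum U a) (enum U b) (⊆S∪B (enum∈ U a) (proj₂ (∈─⁻ ⊤ _ ma) ∘ restrict∈⁺ U A))
                                   (⊆S∪B (enum∈ U b) (proj₂ (∈─⁻ ⊤ _ mb) ∘ restrict∈⁺ U A)) (a≢b ∘ enum-injective U)
    side-maximal : ∀ (A B : Subset n) → (∀ v → v ∈ A → ∃[ y ] (y ∈ B × adj G v y ≡ false)) → B ⊆ U →
                   (∀ {x} → x ∈ B → x ∉ A) → ∀ v → v ∈ restrict U A → ¬ IsClique (induced G U) ((⊤ ─ restrict U A) ∪ ⁅ v ⁆)
    side-maximal A B stuck B⊆U B∩A v v∈A clique with stuck (enum U v) (restrict∈⁻ U A v∈A)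
    ... | y , y∈B , nonadjacent with enum-surjective U (B⊆U y∈B)
    ...   | y′ , refl = true≢false (trans (sym (clique v y′ (x∈p∪q⁺ (inj₂ (x∈⁅x⁆ v)))
                                                      (x∈p∪q⁺ (inj₁ (x∈p∧x∉q⇒x∈p─q ∈⊤ (B∩A y∈B ∘ restrict∈⁻ U A)))) v≢y′)) nonadjacent)
      where
      v≢y′ : v ≢ y′
      v≢y′ e = B∩A y∈B (subst (λ z → enum U z ∈ A) e (restrict∈⁻ U A v∈A))
    ∉T₀ : ∀ {x} → x ∈ U → x ∉ T₀ → x ∈ S ∪ T₁
    ∉T₀ m x∉T₀ with U⁻ m
    ... | inj₁ x∈S = x∈p∪q⁺ (inj₁ x∈S)
    ... | inj₂ (zero , x∈T₀) = absurd (x∉T₀ x∈T₀)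
    ... | inj₂ (suc zero , x∈T₁) = x∈p∪q⁺ (inj₂ x∈T₁)
    ∉T₁ : ∀ {x} → x ∈ U → x ∉ T₁ → x ∈ S ∪ T₀
    ∉T₁ m x∉T₁ with U⁻ m
    ... | inj₁ x∈S = x∈p∪q⁺ (inj₁ x∈S)
    ... | inj₂ (zero , x∈T₀) = x∈p∪q⁺ (inj₂ x∈T₀)
    ... | inj₂ (suc zero , x∈T₁) = absurd (x∉T₁ x∈T₁)
    sides : ∀ i → IsClique (induced G U) (⊤ ─ TU i) × (∀ v → v ∈ TU i → ¬ IsClique (induced G U) ((⊤ ─ TU i) ∪ ⁅ v ⁆))
    sides zero = side-clique T₀ T₁ ∉T₀ S∪T₁-clique , side-maximal T₀ T₁ stuck₀ (T⊆U (suc zero)) (λ m₁ m₀ → T₀∩T₁ m₀ m₁)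
    sides (suc zero) = side-clique T₁ T₀ ∉T₁ S∪T₀-clique , side-maximal T₁ T₀ stuck₁ (T⊆U zero) T₀∩T₁
-- Condition (v): the graph Φ_q(G)

module _ {n : ℕ} (G : Graph n) where

  ΦAdj? : ∀ K K′ → Dec (ΦAdj G K K′)
  ΦAdj? K K′ with K ≟ˢ K′
  ... | yes K≡K′ = no (λ a → proj₁ a K≡K′)
  ... | no K≢K′ with clique? G (K ∪ K′)
  ...   | yes clique = yes (K≢K′ , K ∪ K′ , clique , p⊆p∪q K′ , q⊆p∪q K K′)
  ...   | no ¬clique = no (λ (_ , C , C-clique , K⊆C , K′⊆C) → ¬clique (clique-⊆ G (∪-⊆ K⊆C K′⊆C) C-clique))

  ΦAdj-sym : ∀ {K K′} → ΦAdj G K K′ → ΦAdj G K′ K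
  ΦAdj-sym (K≢K′ , C , clique , K⊆C , K′⊆C) = K≢K′ ∘ sym , C , clique , K′⊆C , K⊆C

  does≡true⇔ : ∀ {A : Set} (d : Dec A) → (does d ≡ true) ⇔ A
  does≡true⇔ (yes a) = mk⇔ (λ _ → a) (λ _ → refl)
  does≡true⇔ (no ¬a) = mk⇔ (λ ()) (absurd ∘ ¬a)

  Φgraph : ∀ {k} → (Fin k → Subset n) → Graph k
  Φgraph f = record
    { adj = λ a b → does (ΦAdj? (f a) (f b))
    ; sym = λ a b → does-⇔ (mk⇔ ΦAdj-sym ΦAdj-sym) (ΦAdj? (f a) (f b)) (ΦAdj? (f b) (f a))
    ; irrefl = λ a → dec-false (ΦAdj? (f a) (f a)) (λ (≢ , _) → ≢ refl) }

  Φgraph-embedding : ∀ {k} q (f : Fin k → Subset n) → (∀ i → ΦVertex G q (f i)) → Injective _≡_ _≡_ f →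
                     ΦInducedEmbedding (Φgraph f) G q f
  Φgraph-embedding q f vertex injective = vertex , injective , (λ i j → does≡true⇔ (ΦAdj? (f i) (f j)))

  ΦAdj⁺ : ∀ {k} (f : Fin k → Subset n) {a b} → ΦAdj G (f a) (f b) → Adj (Φgraph f) a b
  ΦAdj⁺ f {a} {b} = Equivalence.from (does≡true⇔ (ΦAdj? (f a) (f b)))

  ΦAdj⁻ : ∀ {k} (f : Fin k → Subset n) {a b} → Adj (Φgraph f) a b → ΦAdj G (f a) (f b)
  ΦAdj⁻ f {a} {b} = Equivalence.to (does≡true⇔ (ΦAdj? (f a) (f b)))

unionOver : ∀ {k n} → Subset k → (Fin k → Subset n) → Subset n
unionOver M f = tabulate (λ x → does (any? (λ z → (z ∈? M) ×-dec (x ∈? f z))))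

unionOver⁺ : ∀ {k n} (M : Subset k) (f : Fin k → Subset n) {z x} → z ∈ M → x ∈ f z → x ∈ unionOver M f
unionOver⁺ M f {z} {x} z∈M x∈fz = ∈tabulate⁺ _ (dec-true (any? (λ z → (z ∈? M) ×-dec (x ∈? f z))) (z , z∈M , x∈fz))

unionOver⁻ : ∀ {k n} (M : Subset k) (f : Fin k → Subset n) {x} → x ∈ unionOver M f → ∃[ z ] (z ∈ M × x ∈ f z)
unionOver⁻ M f {x} m with any? (λ z → (z ∈? M) ×-dec (x ∈? f z)) | ∈tabulate⁻ (λ x → does (any? (λ z → (z ∈? M) ×-dec (x ∈? f z)))) m
... | yes found | _ = found
... | no _ | ()

-- The union of the q-cliques in a clique M j of H ↪ Φ_q(G) is a clique of G;
-- extending these unions gives the critical family, the q-clique f (witness j)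
-- lying in all of them but the j-th.
Φ-critical⇒critical : ∀ {k n p q} {H : Graph k} {G : Graph n} {f : Fin k → Subset n} →
                      ΦInducedEmbedding H G q f → CriticalCliques H p 1 → CriticalCliques G p q
Φ-critical⇒critical {n = n} {p} {q} {H} {G} {f} (vertex , f-injective , f-adj) P = record
  { member = M′ ; inFamily = maximal ; large = large′ ; witness = proj₁ ∘ witness′
  ; witness∈ = λ j → in-all-but j (proj₁ (proj₂ (witness′ j))) ; witness∉ = λ j → proj₂ (proj₂ (witness′ j)) }
  where
  open Critical P
  N : Fin (suc p) → Subset n
  N j = unionOver (member j) f
  N-clique : ∀ j → IsClique G (N j)
  N-clique j u v mu mv u≢v with unionOver⁻ (member j) f mu | unionOver⁻ (member j) f mv
  ... | a , a∈M , u∈fa | b , b∈M , v∈fb with a ≟ b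
  ...   | yes refl = proj₁ (vertex a) u v u∈fa v∈fb u≢v
  ...   | no a≢b with Equivalence.to (f-adj a b) (proj₁ (inFamily j) a b a∈M b∈M a≢b)
  ...     | _ , C , C-clique , fa⊆C , fb⊆C = C-clique u v (fa⊆C u∈fa) (fb⊆C v∈fb) u≢v
  extended : ∀ j → Σ[ K ∈ Subset n ] (MaximalClique G K × N j ⊆ K)
  extended j = extendToMaximal G (N j) (N-clique j)
  M′ : Fin (suc p) → Subset n
  M′ j = proj₁ (extended j)
  maximal : ∀ j → MaximalClique G (M′ j)
  maximal j = proj₁ (proj₂ (extended j))
  ⊆M′ : ∀ j {z x} → z ∈ member j → x ∈ f z → x ∈ M′ j
  ⊆M′ j z∈M x∈fz = proj₂ (proj₂ (extended j)) (unionOver⁺ (member j) f z∈M x∈fz)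
  in-all-but : ∀ j {x} → x ∈ f (witness j) → x ∈ coreExcept j M′
  in-all-but j x∈f = coreExcept⁺ j M′ (λ i i≢j → ⊆M′ i (coreExcept⁻ j member (witness∈ j) i i≢j) x∈f)
  large′ : ∀ j → q ≤ ∣ coreExcept j M′ ∣
  large′ j = subst (_≤ ∣ coreExcept j M′ ∣) (proj₂ (vertex (witness j))) (p⊆q⇒∣p∣≤∣q∣ (in-all-but j))
  -- If f (witness j) ⊆ M′ j, then witness j would be adjacent to its non-neighbour in member j.
  witness′ : ∀ j → ∃[ x ] (x ∈ f (witness j) × x ∉ M′ j)
  witness′ j = ⊈⇒witness (f (witness j)) (M′ j) λ fw⊆M′ →
    let (y , y∈M , y≢w , nonadjacent) = nonNeighbour H (inFamily j) (witness∉ j) in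
    true≢false (trans (sym (Equivalence.from (f-adj (witness j) y)
                         ((y≢w ∘ sym ∘ f-injective) , M′ j , proj₁ (maximal j) , fw⊆M′ , ⊆M′ j y∈M))) nonadjacent)

emptyCore⇒¬helly : ∀ {k p} (H : Graph k) (P : CriticalCliques H p 1) →
                   Empty (core (Critical.family P)) → ¬ CliqueHelly p 1 H
emptyCore⇒¬helly H P empty helly = empty (1≤∣p∣⇒Nonempty _ (helly family family≢[] family⊆Fam intersecting))
  where open Critical P

∣S∪T∣≡q : ∀ {n q s} {S T : Subset n} → s < q → ∣ S ∣ ≡ s → ∣ T ∣ ≡ q ∸ s → Empty (S ∩ T) → ∣ S ∪ T ∣ ≡ q
∣S∪T∣≡q {S = S} {T} s<q ∣S∣≡s ∣T∣≡q∸s disjoint =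
  trans (∣p∪q∣≡∣p∣+∣q∣ S T disjoint) (trans (cong₂ _+_ ∣S∣≡s ∣T∣≡q∸s) (m+[n∸m]≡n (<⇒≤ s<q)))

-- S ∪ T₀ and S ∪ T₁ are non-adjacent vertices of Φ_q(G), and two non-adjacent
-- vertices are not 1-clique-Helly for p = 1.
pair⇒¬v : ∀ q {n} (G : Graph n) → PairReduction.PairState q G → ¬ Conditions.cond-v 1 q G
pair⇒¬v q G V v = emptyCore⇒¬helly H P emptyCore (v 2 H Q (Φgraph-embedding G q Q vertex Q-injective))
  where
  open PairReduction.PairState V
  Q : Fin 2 → Subset _
  Q zero = S ∪ T₀
  Q (suc zero) = S ∪ T₁
  vertex : ∀ i → ΦVertex G q (Q i)
  vertex zero = S∪T₀-clique , ∣S∪T∣≡q s<q ∣S∣≡s ∣T₀∣≡q∸s S-T₀-disjoint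
  vertex (suc zero) = S∪T₁-clique , ∣S∪T∣≡q s<q ∣S∣≡s ∣T₁∣≡q∸s S-T₁-disjoint
  x₀∉Q₁ : x₀ ∉ Q (suc zero)
  x₀∉Q₁ m with x∈p∪q⁻ S T₁ m
  ... | inj₁ x₀∈S = S-T₀-disjoint (x₀ , x∈p∩q⁺ (x₀∈S , x₀∈T₀))
  ... | inj₂ x₀∈T₁ = T₀∩T₁ x₀∈T₀ x₀∈T₁
  Q-injective : Injective _≡_ _≡_ Q
  Q-injective {zero} {zero} _ = refl
  Q-injective {zero} {suc zero} e = absurd (x₀∉Q₁ (subst (x₀ ∈_) e (x∈p∪q⁺ (inj₂ x₀∈T₀))))
  Q-injective {suc zero} {zero} e = absurd (x₀∉Q₁ (subst (x₀ ∈_) (sym e) (x∈p∪q⁺ (inj₂ x₀∈T₀))))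
  Q-injective {suc zero} {suc zero} _ = refl
  ¬ΦAdj : ∀ a b → a ≢ b → ¬ ΦAdj G (Q a) (Q b)
  ¬ΦAdj zero zero 0≢0 = absurd (0≢0 refl)
  ¬ΦAdj zero (suc zero) _ (_ , C , C-clique , Q₀⊆C , Q₁⊆C) =
    true≢false (trans (sym (C-clique x₀ x₁ (Q₀⊆C (x∈p∪q⁺ (inj₂ x₀∈T₀))) (Q₁⊆C (x∈p∪q⁺ (inj₂ x₁∈T₁))) x₀≢x₁)) x₀x₁-nonadjacent)
    where
    x₀≢x₁ : x₀ ≢ x₁
    x₀≢x₁ e = T₀∩T₁ x₀∈T₀ (subst (_∈ T₁) (sym e) x₁∈T₁)
  ¬ΦAdj (suc zero) zero 1≢0 adjacent = ¬ΦAdj zero (suc zero) (1≢0 ∘ sym) (ΦAdj-sym G adjacent)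
  ¬ΦAdj (suc zero) (suc zero) 1≢1 = absurd (1≢1 refl)
  H : Graph 2
  H = Φgraph G Q
  other : Fin 2 → Fin 2
  other zero = suc zero
  other (suc zero) = zero
  other≢ : ∀ a → other a ≢ a
  other≢ zero ()
  other≢ (suc zero) ()
  only-other : ∀ a b → b ≢ a → b ≡ other a
  only-other zero zero 0≢0 = absurd (0≢0 refl)
  only-other zero (suc zero) _ = refl
  only-other (suc zero) zero _ = refl
  only-other (suc zero) (suc zero) 1≢1 = absurd (1≢1 refl)
  singleton-maximal : ∀ a → MaximalClique H ⁅ a ⁆
  singleton-maximal a = (λ u v mu mv u≢v → absurd (u≢v (trans (x∈⁅y⁆⇒x≡y a mu) (sym (x∈⁅y⁆⇒x≡y a mv))))) , maximal
    where
    maximal : ∀ C → IsClique H C → ⁅ a ⁆ ⊆ C → C ⊆ ⁅ a ⁆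
    maximal C C-clique a∈C {z} z∈C with z ≟ a
    ... | yes refl = x∈⁅x⁆ z
    ... | no z≢a = absurd (¬ΦAdj a z (z≢a ∘ sym) (ΦAdj⁻ G Q {a} {z} (C-clique a z (a∈C (x∈⁅x⁆ a)) z∈C (z≢a ∘ sym))))
  other∈ : ∀ j → other j ∈ coreExcept j ⁅_⁆
  other∈ j = coreExcept⁺ j ⁅_⁆ (λ i i≢j → subst (λ z → other j ∈ ⁅ z ⁆) (sym (only-other j i i≢j)) (x∈⁅x⁆ (other j)))
  P : CriticalCliques H 1 1
  P = record
    { member = ⁅_⁆ ; inFamily = singleton-maximal ; large = λ j → ∈⇒1≤∣p∣ (other∈ j)
    ; witness = other ; witness∈ = other∈ ; witness∉ = λ j m → other≢ j (x∈⁅y⁆⇒x≡y j m) }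
  emptyCore : Empty (core (Critical.family P))
  emptyCore (x , m) with ∈⋂-tabulate⁻ ⁅_⁆ m zero | ∈⋂-tabulate⁻ ⁅_⁆ m (suc zero)
  ... | x∈⁅0⁆ | x∈⁅1⁆ with trans (sym (x∈⁅y⁆⇒x≡y zero x∈⁅0⁆)) (x∈⁅y⁆⇒x≡y (suc zero) x∈⁅1⁆)
  ...   | ()

-- The q-cliques Q j = S ∪ T j and R i = {w i} ∪ Y i, with Y i any (q ∸ 1)-subset
-- of U ─ T i.  The sets C i = {Q j | j ≢ i} ∪ {R i} are maximal cliques of the
-- induced subgraph of Φ_q(G) (they lie in the clique (U ─ T i) ∪ {w i}, while
-- Q i and R i are not adjacent), any p of them share a vertex, and all p+1 share none.
module EyesΦ (p q : ℕ) {n : ℕ} (G : Graph n) (p≥2 : 2 ≤ p) (eyed : Reduction.EyedState p q G p≥2) where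
  open Eyed p q G p≥2 eyed

  p≥1 : 1 ≤ p
  p≥1 = ≤-trans (s≤s z≤n) p≥2

  Q : Fin (suc p) → Subset n
  Q j = S ∪ T j

  Q⊆U─T : ∀ i j → j ≢ i → Q j ⊆ U ─ T i
  Q⊆U─T i j j≢i = ∪-⊆ (S⊆U─T i) (T⊆U─T i j j≢i)

  ∣Q∣≡q : ∀ j → ∣ Q j ∣ ≡ q
  ∣Q∣≡q j = ∣S∪T∣≡q s<q ∣S∣≡s (∣T∣≡q∸s j) (S-T-disjoint j)

  side : Fin (suc p) → Subset n
  side i = (U ─ T i) ∪ ⁅ w i ⁆

  side-clique : ∀ i → IsClique G (side i)
  side-clique i = clique-∪⁅⁆ G (clique-⊆ G (p─q⊆p U (T i)) U-clique) (proj₁ (eye i))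

  chosenY : ∀ i → Σ[ Y ∈ Subset n ] (Y ⊆ U ─ T i × ∣ Y ∣ ≡ q ∸ 1)
  chosenY i = subsetOfSize (U ─ T i) (q ∸ 1)
    (≤-trans (m∸n≤m q 1) (subst (_≤ ∣ U ─ T i ∣) (∣Q∣≡q j) (p⊆q⇒∣p∣≤∣q∣ (Q⊆U─T i j (punchInᵢ≢i i (fromℕ< p≥1))))))
    where
    j : Fin (suc p)
    j = punchIn i (fromℕ< p≥1)

  Rᵢ : Fin (suc p) → Subset n
  Rᵢ i = ⁅ w i ⁆ ∪ proj₁ (chosenY i)

  Y⊆U : ∀ i → proj₁ (chosenY i) ⊆ U
  Y⊆U i m = proj₁ (∈─⁻ U (T i) (proj₁ (proj₂ (chosenY i)) m))

  R⊆side : ∀ i → Rᵢ i ⊆ side i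
  R⊆side i = ∪-⊆ (λ m → x∈p∪q⁺ (inj₂ m)) (λ m → x∈p∪q⁺ (inj₁ (proj₁ (proj₂ (chosenY i)) m)))

  ∣R∣≡q : ∀ i → ∣ Rᵢ i ∣ ≡ q
  ∣R∣≡q i = trans (trans (∣p∪q∣≡∣p∣+∣q∣ ⁅ w i ⁆ _ disjoint) (cong₂ _+_ (∣⁅x⁆∣≡1 (w i)) (proj₂ (proj₂ (chosenY i)))))
                  (m+[n∸m]≡n (≤-trans (s≤s z≤n) s<q))
    where
    disjoint : Empty (⁅ w i ⁆ ∩ proj₁ (chosenY i))
    disjoint (x , m) = w∉U i (subst (_∈ U) (x∈⁅y⁆⇒x≡y (w i) (proj₁ (x∈p∩q⁻ ⁅ w i ⁆ _ m))) (Y⊆U i (proj₂ (x∈p∩q⁻ ⁅ w i ⁆ _ m))))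

  w∈R : ∀ i → w i ∈ Rᵢ i
  w∈R i = x∈p∪q⁺ (inj₁ (x∈⁅x⁆ (w i)))

  w∈R⁻ : ∀ i j → w i ∈ Rᵢ j → i ≡ j
  w∈R⁻ i j m with x∈p∪q⁻ ⁅ w j ⁆ _ m
  ... | inj₁ m⁅⁆ = w-injective (x∈⁅y⁆⇒x≡y (w j) m⁅⁆)
  ... | inj₂ mY = absurd (w∉U i (Y⊆U j mY))

  Q-R-nonadjacent : ∀ i → ¬ ΦAdj G (Q i) (Rᵢ i)
  Q-R-nonadjacent i (_ , C , C-clique , Q⊆C , R⊆C) =
    true≢false (trans (sym (C-clique (w i) (y i) (R⊆C (w∈R i)) (Q⊆C (x∈p∪q⁺ (inj₂ (y∈T i)))) w≢y)) (w-y-nonadjacent i))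
    where
    w≢y : w i ≢ y i
    w≢y e = w∉U i (subst (_∈ U) (sym e) (T⊆U i (y∈T i)))

  -- Vertices of the Φ-subgraph: inj₁ j stands for Q j and inj₂ i for R i.
  vertex : Fin (suc p) ⊎ Fin (suc p) → Subset n
  vertex (inj₁ j) = Q j
  vertex (inj₂ i) = Rᵢ i

  vertex-injective : ∀ {a b} → vertex a ≡ vertex b → a ≡ b
  vertex-injective {inj₁ j} {inj₁ j′} e with j ≟ j′
  ... | yes refl = refl
  ... | no j≢j′ with x∈p∪q⁻ S (T j′) (subst (y j ∈_) e (x∈p∪q⁺ (inj₂ (y∈T j))))
  ...   | inj₁ y∈S = absurd (S-T-disjoint j (_ , x∈p∩q⁺ (y∈S , y∈T j)))
  ...   | inj₂ y∈T′ = absurd (T-disjoint j j′ j≢j′ (_ , x∈p∩q⁺ (y∈T j , y∈T′)))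
  vertex-injective {inj₁ j} {inj₂ i} e = absurd (w∉U i (∪-⊆ S⊆U (T⊆U j) (subst (w i ∈_) (sym e) (w∈R i))))
  vertex-injective {inj₂ i} {inj₁ j} e = absurd (w∉U i (∪-⊆ S⊆U (T⊆U j) (subst (w i ∈_) e (w∈R i))))
  vertex-injective {inj₂ i} {inj₂ i′} e = cong inj₂ (w∈R⁻ i i′ (subst (w i ∈_) e (w∈R i)))

  vertex-ΦVertex : ∀ a → ΦVertex G q (vertex a)
  vertex-ΦVertex (inj₁ j) = clique-⊆ G (∪-⊆ S⊆U (T⊆U j)) U-clique , ∣Q∣≡q j
  vertex-ΦVertex (inj₂ i) = clique-⊆ G (R⊆side i) (side-clique i) , ∣R∣≡q i

  k : ℕ
  k = suc p + suc p

  decode : Fin k → Fin (suc p) ⊎ Fin (suc p)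
  decode = splitAt (suc p)

  f : Fin k → Subset n
  f = vertex ∘ decode

  f-injective : Injective _≡_ _≡_ f
  f-injective {a} {b} e =
    trans (sym (join-splitAt (suc p) (suc p) a))
          (trans (cong (join (suc p) (suc p)) (vertex-injective {decode a} {decode b} e)) (join-splitAt (suc p) (suc p) b))

  H : Graph k
  H = Φgraph G f

  InC : Fin (suc p) → Fin (suc p) ⊎ Fin (suc p) → Set
  InC i (inj₁ j) = j ≢ i
  InC i (inj₂ i′) = i′ ≡ i

  InC? : ∀ i a → Dec (InC i a)
  InC? i (inj₁ j) = ¬? (j ≟ i)
  InC? i (inj₂ i′) = i′ ≟ i

  C : Fin (suc p) → Subset k
  C i = tabulate (λ x → does (InC? i (decode x)))

  C⁺ : ∀ i {x} → InC i (decode x) → x ∈ C i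
  C⁺ i {x} h = ∈tabulate⁺ (λ x → does (InC? i (decode x))) (dec-true (InC? i (decode x)) h)

  C⁻ : ∀ i {x} → x ∈ C i → InC i (decode x)
  C⁻ i {x} m with InC? i (decode x) | ∈tabulate⁻ (λ x → does (InC? i (decode x))) m
  ... | yes h | _ = h
  ... | no _ | ()

  vertex⊆side : ∀ i a → InC i a → vertex a ⊆ side i
  vertex⊆side i (inj₁ j) j≢i m = x∈p∪q⁺ (inj₁ (Q⊆U─T i j j≢i m))
  vertex⊆side i (inj₂ .i) refl m = R⊆side i m

  Q-index : Fin (suc p) → Fin k
  Q-index j = j ↑ˡ suc p

  R-index : Fin (suc p) → Fin k
  R-index i = suc p ↑ʳ i

  decode-Q : ∀ j → decode (Q-index j) ≡ inj₁ j
  decode-Q j = splitAt-↑ˡ (suc p) j (suc p)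

  decode-R : ∀ i → decode (R-index i) ≡ inj₂ i
  decode-R i = splitAt-↑ʳ (suc p) (suc p) i

  ΦAdj-decoded : ∀ {a b c d} → decode a ≡ c → decode b ≡ d → Adj H a b → ΦAdj G (vertex c) (vertex d)
  ΦAdj-decoded {a} {b} refl refl = ΦAdj⁻ G f {a} {b}

  C-clique : ∀ i → IsClique H (C i)
  C-clique i a b ma mb a≢b =
    ΦAdj⁺ G f {a} {b} (a≢b ∘ f-injective , side i , side-clique i ,
                       vertex⊆side i (decode a) (C⁻ i ma) , vertex⊆side i (decode b) (C⁻ i mb))

  -- Q i and R i are the only vertices outside C i, and each is non-adjacent to a member.
  C-maximal : ∀ i → MaximalClique H (C i)
  C-maximal i = C-clique i , maximal
    where
    maximal : ∀ C′ → IsClique H C′ → C i ⊆ C′ → C′ ⊆ C i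
    maximal C′ C′-clique C⊆C′ {z} z∈C′ with decode z in eq
    ... | inj₁ j with j ≟ i
    ...   | no j≢i = C⁺ i (subst (InC i) (sym eq) j≢i)
    ...   | yes refl = absurd (Q-R-nonadjacent i (ΦAdj-decoded {z} {R-index i} eq (decode-R i)
                         (C′-clique z (R-index i) z∈C′ (C⊆C′ (C⁺ i (subst (InC i) (sym (decode-R i)) refl))) z≢R)))
      where
      z≢R : z ≢ R-index i
      z≢R e with trans (sym eq) (trans (cong decode e) (decode-R i))
      ... | ()
    maximal C′ C′-clique C⊆C′ {z} z∈C′ | inj₂ i′ with i′ ≟ i
    ...   | yes i′≡i = C⁺ i (subst (InC i) (sym eq) i′≡i)
    ...   | no i′≢i = absurd (Q-R-nonadjacent i′ (ΦAdj-sym G (ΦAdj-decoded {z} {Q-index i′} eq (decode-Q i′)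
                         (C′-clique z (Q-index i′) z∈C′ (C⊆C′ (C⁺ i (subst (InC i) (sym (decode-Q i′)) i′≢i))) z≢Q))))
      where
      z≢Q : z ≢ Q-index i′
      z≢Q e with trans (sym eq) (trans (cong decode e) (decode-Q i′))
      ... | ()

  Q∈coreExcept : ∀ i → Q-index i ∈ coreExcept i C
  Q∈coreExcept i = coreExcept⁺ i C (λ j j≢i → C⁺ j (subst (InC j) (sym (decode-Q i)) (j≢i ∘ sym)))

  P : CriticalCliques H p 1
  P = record
    { member = C ; inFamily = C-maximal ; large = λ i → ∈⇒1≤∣p∣ (Q∈coreExcept i)
    ; witness = Q-index ; witness∈ = Q∈coreExcept
    ; witness∉ = λ i m → subst (InC i) (decode-Q i) (C⁻ i m) refl }

  emptyCore : Empty (core (Critical.family P))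
  emptyCore (x , m) with decode x in eq
  ... | inj₁ j = subst (InC j) eq (C⁻ j (∈⋂-tabulate⁻ C m j)) refl
  ... | inj₂ i = punchInᵢ≢i i (fromℕ< p≥1) (sym (subst (InC j) eq (C⁻ j (∈⋂-tabulate⁻ C m j))))
    where
    j : Fin (suc p)
    j = punchIn i (fromℕ< p≥1)

  ¬v : ¬ Conditions.cond-v p q G
  ¬v v = emptyCore⇒¬helly H P emptyCore (v k H f (Φgraph-embedding G q f (vertex-ΦVertex ∘ decode) f-injective))

InducedOcular : ∀ {n} → Graph n → ℕ → ℕ → Set
InducedOcular {n} G p q = Σ[ X ∈ Subset n ] Σ[ s ∈ ℕ ] (s < q × Ocular p q s (induced G X))

critical⇒ocular : ∀ p q {n} (G : Graph n) → 1 ≤ p → 1 ≤ q → CriticalCliques G p q → InducedOcular G p q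
critical⇒ocular (suc zero) q G _ q≥1 P =
  let (V , stuck) = PairReduction.jconfig⇒stuck q G (critical⇒JConfig G q≥1 P) in stuck⇒ocular q G V stuck
critical⇒ocular (suc (suc p)) q G _ q≥1 P =
  Eyed.ocular (suc (suc p)) q G (s≤s (s≤s z≤n)) (Reduction.jconfig⇒eyed (suc (suc p)) q G (s≤s (s≤s z≤n)) (critical⇒JConfig G q≥1 P))

v⇒¬critical : ∀ p q {n} (G : Graph n) → 1 ≤ p → 1 ≤ q → Conditions.cond-v p q G → ¬ CriticalCliques G p q
v⇒¬critical (suc zero) q G _ q≥1 v P = pair⇒¬v q G (PairReduction.jconfig⇒pairState q G (critical⇒JConfig G q≥1 P)) v
v⇒¬critical (suc (suc p)) q G _ q≥1 v P =
  EyesΦ.¬v (suc (suc p)) q G (s≤s (s≤s z≤n)) (Reduction.jconfig⇒eyed (suc (suc p)) q G (s≤s (s≤s z≤n)) (critical⇒JConfig G q≥1 P)) v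

module _ {n : ℕ} (p q : ℕ) (p≥1 : 1 ≤ p) (q≥1 : 1 ≤ q) (G : Graph n) where
  open Conditions p q G

  i⇔¬critical : cond-i ⇔ (¬ CriticalCliques G p q)
  i⇔¬critical = mk⇔
    (λ i P → let (X , s , s<q , ocular) = critical⇒ocular p q G p≥1 q≥1 P in
      ocular⇒¬cliqueHelly (induced G X) p≥1 s<q ocular (i _ (induced G X) (enum X) (induced-embedding G X)))
    (¬critical⇒i p q p≥1 G)

  v⇔¬critical : cond-v ⇔ (¬ CriticalCliques G p q)
  v⇔¬critical = mk⇔ (v⇒¬critical p q G p≥1 q≥1)
    (λ ¬critical k H f emb → ¬critical⇒cliqueHelly H p≥1 (¬critical ∘ Φ-critical⇒critical {H = H} {G = G} emb))

  vi⇔¬critical : cond-vi ⇔ (¬ CriticalCliques G p q)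
  vi⇔¬critical = mk⇔ (λ vi P → jconfig⇒¬vi p q G (critical⇒JConfig G q≥1 P) vi) (¬critical⇒vi p q G)

  vii⇔¬critical : cond-vii ⇔ (¬ CriticalCliques G p q)
  vii⇔¬critical = mk⇔ (λ vii P → jconfig⇒¬vii p q G (critical⇒JConfig G q≥1 P) vii) (¬critical⇒vii p q G)

  viii⇔¬critical : cond-viii ⇔ (¬ CriticalCliques G p q)
  viii⇔¬critical = mk⇔
    (λ viii P → let (X , s , s<q , ocular) = critical⇒ocular p q G p≥1 q≥1 P in
      viii s s<q _ (induced G X) (enum X) (induced-embedding G X) ocular)
    (λ ¬critical s s<q k H f emb ocular → ocular⇒¬cliqueHelly H p≥1 s<q ocular (¬critical⇒i p q p≥1 G ¬critical k H f emb))

theorem3p12 : ∀ (p q : ℕ) → 1 ≤ p → 1 ≤ q →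
    ∀ {n} (G : Graph n) → Conditions.TFAE p q G
theorem3p12 p q p≥1 q≥1 G =
  via (ii⇔¬critical p q p≥1 G) , via (iii⇔¬critical p q p≥1 G) , via (iv⇔¬critical p q p≥1 G) ,
  via (v⇔¬critical p q p≥1 q≥1 G) , via (vi⇔¬critical p q p≥1 q≥1 G) , via (vii⇔¬critical p q p≥1 q≥1 G) ,
  via (viii⇔¬critical p q p≥1 q≥1 G)
  where
  via : ∀ {C : Set} → C ⇔ (¬ CriticalCliques G p q) → Conditions.cond-i p q G ⇔ C
  via C⇔ = ⇔.trans (i⇔¬critical p q p≥1 q≥1 G) (⇔.sym C⇔)
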